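{- Let $p$ be a prime, and let $C$ be an arithmetic circuit over $\mathbb{F}_p$ of size $s$ and depth $2d$ (with alternating layers of $+$ and $\times$ gates) on $n$ inputs, such that $C(\mathbf{x}) \in \{0,1\}$ for every $\mathbf{x} \in \{0,1\}^n$. Then $C$ is equivalent (on all inputs $\mathbf{x}\in\{0,1\}^n$) to an $\mathsf{AC}^0[p(p-1)]$ circuit $C'$ of size $O(s\cdot p)$ and depth $3d$.
   Context: An arithmetic circuit over $\mathbb{F}_p$ has unbounded fan-in addition and multiplication gates over $\mathbb{F}_p$, with inputs being variables and field constants; size is the number of gates. An $\mathsf{AC}^0[M]$ circuit has unbounded fan-in AND, OR, NOT and $\text{MOD}_{M}$ gates (equivalently, up to wire multiplicities, $\text{MOD}_{M'}$ gates for divisors $M'$ of $M$), where a $\text{MOD}_{M}$ gate outputs $1$ iff the sum of its Boolean inputs is divisible by $M$. -}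

module Defs where

open import Data.Nat using (ℕ; zero; suc; _+_; _*_; _⊔_; NonZero)
open import Data.Nat.DivMod using (_%_)
open import Data.Nat.Divisibility using (_∣_; _∣?_)
open import Data.Bool using (Bool; true; false; _∧_; _∨_; not; if_then_else_)
open import Data.Fin using (Fin; toℕ)
open import Data.List using (List; []; _∷_; foldr; map; length; filter)
open import Data.Vec using (Vec; lookup; _∷ʳ_) renaming ([] to []ᵛ)
open import Relation.Nullary.Decidable using (⌊_⌋)
open import Relation.Binary.PropositionalEquality using (_≡_)

-- Circuits are DAGs presented as straight-line programs: gate number i
-- may read the n input variables, constants, and gates 0 .. i-1.
-- A circuit with s gates has size s; its output is an arbitrary wire.

data Wire (Const : Set) (n k : ℕ) : Set where
  var  : Fin n → Wire Const n k
  cst  : Const → Wire Const n k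
  gate : Fin k → Wire Const n k

data Gates (G : ℕ → Set) : ℕ → Set where
  []  : Gates G 0
  _▷_ : ∀ {k} → Gates G k → G k → Gates G (suc k)

record Circuit (G : ℕ → Set) (Const : Set) (n s : ℕ) : Set where
  constructor circuit
  field
    gates  : Gates G s
    output : Wire Const n s
open Circuit public

values : ∀ {G : ℕ → Set} {A : Set} →
         (∀ {k} → G k → Vec A k → A) → ∀ {k} → Gates G k → Vec A k
values ev []       = []ᵛ
values ev (gs ▷ g) = let v = values ev gs in v ∷ʳ ev g v

wireVal : ∀ {Const A : Set} {n k} →
          (Fin n → A) → (Const → A) → Vec A k → Wire Const n k → A
wireVal x c v (var i)  = x i
wireVal x c v (cst a)  = c a
wireVal x c v (gate j) = lookup v j

maxList : List ℕ → ℕ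
maxList = foldr _⊔_ 0

-- Arithmetic circuits over F_p (elements represented by 0 .. p-1).

data AOp : Set where
  plus times : AOp

record AGate (p n k : ℕ) : Set where
  constructor agate
  field
    op     : AOp
    inputs : List (Wire (Fin p) n k)
open AGate public

ArithCircuit : ℕ → ℕ → ℕ → Set
ArithCircuit p n s = Circuit (AGate p n) (Fin p) n s

bit : Bool → ℕ
bit true  = 1
bit false = 0

sumL prodL : List ℕ → ℕ
sumL  = foldr _+_ 0
prodL = foldr _*_ 1

module _ (p : ℕ) .{{_ : NonZero p}} {n : ℕ} (x : Fin n → Bool) where
  aGateVal : ∀ {k} → AGate p n k → Vec ℕ k → ℕ
  aGateVal (agate plus  ws) v = sumL  (map (wireVal (λ i → bit (x i)) toℕ v) ws) % p
  aGateVal (agate times ws) v = prodL (map (wireVal (λ i → bit (x i)) toℕ v) ws) % p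

evalA : ∀ (p : ℕ) .{{_ : NonZero p}} {n s} → ArithCircuit p n s → (Fin n → Bool) → ℕ
evalA p C x = wireVal (λ i → bit (x i)) toℕ (values (aGateVal p x) (gates C)) (output C) % p

module _ {p n : ℕ} where
  aDepths : ∀ {k} → Gates (AGate p n) k → Vec ℕ k
  aDepths = values (λ g d → suc (maxList (map (wireVal (λ _ → 0) (λ _ → 0) d) (inputs g))))

  aOps : ∀ {k} → Gates (AGate p n) k → Vec AOp k
  aOps = values (λ g _ → op g)

depthA : ∀ {p n s} → ArithCircuit p n s → ℕ
depthA C = wireVal (λ _ → 0) (λ _ → 0) (aDepths (gates C)) (output C)

-- Alternating layers: every gate that feeds a gate has the other operation.
data _≢op_ : AOp → AOp → Set where
  pt : plus ≢op times
  tp : times ≢op plus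

data AllL {A : Set} (P : A → Set) : List A → Set where
  []  : AllL P []
  _∷_ : ∀ {a as} → P a → AllL P as → AllL P (a ∷ as)

childOK : ∀ {p n k} → Vec AOp k → AOp → Wire (Fin p) n k → Set
childOK ops o (var _)  = ⊤' where open import Data.Unit using () renaming (⊤ to ⊤')
childOK ops o (cst _)  = ⊤' where open import Data.Unit using () renaming (⊤ to ⊤')
childOK ops o (gate j) = lookup ops j ≢op o

AlternatingGates : ∀ {p n k} → Gates (AGate p n) k → Set
AlternatingGates []       = Data.Unit.⊤ where import Data.Unit
AlternatingGates (gs ▷ g) =
  AlternatingGates gs × AllL (childOK (aOps gs) (op g)) (inputs g)
  where open import Data.Product using (_×_)

Alternating : ∀ {p n s} → ArithCircuit p n s → Set
Alternating C = AlternatingGates (gates C)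

-- AC0[M] circuits: unbounded fan-in AND, OR, NOT (fan-in 1) and
-- MOD_m gates for divisors m of M (output 1 iff the number of true
-- inputs, counted with multiplicity, is divisible by m).

data BGate (M n k : ℕ) : Set where
  AND OR : List (Wire Bool n k) → BGate M n k
  NOT    : Wire Bool n k → BGate M n k
  MOD    : (m : ℕ) → m ∣ M → List (Wire Bool n k) → BGate M n k

BoolCircuit : ℕ → ℕ → ℕ → Set
BoolCircuit M n s = Circuit (BGate M n) Bool n s

countTrue : List Bool → ℕ
countTrue = sumL ∘' map bit
  where _∘'_ : ∀ {A B C : Set} → (B → C) → (A → B) → A → C
        (f ∘' g) a = f (g a)

module _ {M n : ℕ} (x : Fin n → Bool) where
  bGateVal : ∀ {k} → BGate M n k → Vec Bool k → Bool
  bGateVal (AND ws)     v = foldr _∧_ true  (map (wireVal x (λ b → b) v) ws)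
  bGateVal (OR ws)      v = foldr _∨_ false (map (wireVal x (λ b → b) v) ws)
  bGateVal (NOT w)      v = not (wireVal x (λ b → b) v w)
  bGateVal (MOD m _ ws) v = ⌊ m ∣? countTrue (map (wireVal x (λ b → b) v) ws) ⌋

evalB : ∀ {M n s} → BoolCircuit M n s → (Fin n → Bool) → Bool
evalB C x = wireVal x (λ b → b) (values (bGateVal x) (gates C)) (output C)

module _ {M n : ℕ} where
  bInputs : ∀ {k} → BGate M n k → List (Wire Bool n k)
  bInputs (AND ws)     = ws
  bInputs (OR ws)      = ws
  bInputs (NOT w)      = w ∷ []
  bInputs (MOD _ _ ws) = ws

  bDepths : ∀ {k} → Gates (BGate M n) k → Vec ℕ k
  bDepths = values (λ g d → suc (maxList (map (wireVal (λ _ → 0) (λ _ → 0) d) (bInputs g))))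

depthB : ∀ {M n s} → BoolCircuit M n s → ℕ
depthB C = wireVal (λ _ → 0) (λ _ → 0) (bDepths (gates C)) (output C)

-- A plus gate over F_p is a MOD_p test: its value is a iff Σ vᵢ + (p − a) ≡ 0 (mod p),
-- where each input vᵢ is fed to the MOD gate as vᵢ true wires, namely the indicator
-- [vᵢ = b] repeated b times for every 0 < b < p. A times gate becomes additive through
-- a discrete logarithm to a primitive root: for nonzero inputs, Π vᵢ = a iff
-- Σ log vᵢ + (p − 1 − log a) ≡ 0 (mod p − 1), a MOD_(p−1) test, and a zero input is
-- caught by an AND of "nonzero" wires. Keeping for every arithmetic gate the wires
-- [value = b] (0 < b < p) and [value ≠ 0] costs at most 2p + 1 Boolean gates per
-- arithmetic gate; a plus layer adds one Boolean layer and a times layer two, so 2d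
-- alternating layers need depth 3d. A primitive root exists because every unit is a
-- root of x^e − 1 for the maximal order e, and that polynomial has at most e roots.

module Submission where

open import Defs
open import Data.Nat
open import Data.Nat.Properties
open import Data.Nat.DivMod
open import Data.Nat.Divisibility
open import Data.Nat.Coprimality as Coprimality using (Coprime; coprime-divisor)
open import Data.Nat.Primality using (Prime; euclidsLemma; prime⇒nonZero; prime⇒nonTrivial; prime⇒irreducible)
open import Data.Nat.Primality.Factorisation using (factorise; PrimeFactorisation)
open import Data.Nat.Induction using (<-rec)
open import Data.Nat.ListAction using (product)
open import Data.Nat.ListAction.Properties using (sum-++)
open import Data.Nat.Tactic.RingSolver using (solve-∀)
open import Data.Integer.Base as ℤ using (ℤ)
import Data.Integer.Properties as ℤ
open import Data.Integer.Divisibility.Signed using (∣ᵤ⇒∣; ∣⇒∣ᵤ; ∣m∣n⇒∣m-n)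
  renaming (_∣_ to _∣ℤ_; divides to dividesℤ)
open import Data.Integer.Solver using (module +-*-Solver)
open import Data.Bool using (Bool; true; false; _∧_; _∨_; not; if_then_else_)
open import Data.Bool.Properties using (∧-identityʳ; ∧-zeroʳ)
open import Data.Fin as Fin using (Fin; toℕ; fromℕ; fromℕ<; inject₁; punchOut)
open import Data.Fin.Properties
  using (toℕ<n; toℕ-injective; fromℕ<-injective; punchOut-injective; injective⇒≤; any?; pigeonhole)
open import Data.Vec using (Vec; lookup; _∷ʳ_) renaming ([] to []ᵛ; _∷_ to _∷ᵛ_)
open import Data.List using (List; []; _∷_; _++_; map; foldr; replicate; concatMap; applyUpTo; length)
open import Data.List.Properties
  using (map-++; map-replicate; map-cong; map-cong-local; map-∘; length-applyUpTo; length-replicate)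
open import Data.List.Relation.Unary.All as All using (All; []; _∷_)
open import Data.List.Relation.Unary.All.Properties using (++⁺; map⁺; map⁻; replicate⁺; applyUpTo⁺₁; applyUpTo⁻)
open import Data.List.Relation.Unary.AllPairs using (AllPairs; []; _∷_)
import Data.List.Relation.Unary.AllPairs.Properties as AllPairs
open import Data.List.Extrema.Nat using (argmax; f[xs]≤f[argmax]; argmax-all)
open import Data.Product using (Σ; ∃; ∃₂; _×_; _,_; proj₁; proj₂)
open import Data.Sum as Sum using (_⊎_; inj₁; inj₂)
open import Function using (id; _∘_)
open import Function.Bundles using (_⇔_; mk⇔)
open import Relation.Nullary using (Dec; yes; no; ¬_; contradiction; _×-dec_)
open import Relation.Nullary.Decidable using (⌊_⌋; isYes≗does; dec-true; dec-false; does-⇔)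
open import Relation.Binary.PropositionalEquality

leastWitness : ∀ {P : ℕ → Set} → (∀ n → Dec (P n)) → ∀ {n} → P n →
               ∃ λ m → m ≤ n × P m × (∀ {k} → k < m → ¬ P k)
leastWitness {P} P? {n} = <-rec Goal search n
  where
  Goal : ℕ → Set
  Goal n = P n → ∃ λ m → m ≤ n × P m × (∀ {k} → k < m → ¬ P k)
  search : ∀ n → (∀ {k} → k < n → Goal k) → Goal n
  search n rec Pn with anyUpTo? P? n
  ... | yes (k , k<n , Pk) =
    let m , m≤k , Pm , least = rec k<n Pk in m , ≤-trans m≤k (<⇒≤ k<n) , Pm , least
  ... | no ∄ = n , ≤-refl , Pn , λ k<n Pk → ∄ (_ , k<n , Pk)

injective⇒surjective : ∀ {n} {f : Fin n → Fin n} → (∀ {i j} → f i ≡ f j → i ≡ j) → ∀ j → ∃ λ i → f i ≡ j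
injective⇒surjective {suc n} {f} f-inj j with any? (λ i → f i Fin.≟ j)
... | yes hit = hit
... | no miss = contradiction (injective⇒≤ {f = squeeze} squeeze-inj) 1+n≰n
  where
  squeeze : Fin (suc n) → Fin n
  squeeze i = punchOut {i = j} λ j≡fi → miss (i , sym j≡fi)
  squeeze-inj : ∀ {i i′} → squeeze i ≡ squeeze i′ → i ≡ i′
  squeeze-inj eq = f-inj (punchOut-injective {i = j} _ _ eq)

^-distribʳ-* : ∀ a b t → (a * b) ^ t ≡ a ^ t * b ^ t
^-distribʳ-* a b zero = refl
^-distribʳ-* a b (suc t) rewrite ^-distribʳ-* a b t = shuffle a b (a ^ t) (b ^ t)
  where
  shuffle : ∀ a b x y → a * b * (x * y) ≡ a * x * (b * y)
  shuffle = solve-∀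

^-monoʳ-∣ : ∀ q {i j} → i ≤ j → q ^ i ∣ q ^ j
^-monoʳ-∣ q {i} {j} i≤j = divides (q ^ (j ∸ i)) (begin
  q ^ j             ≡⟨ cong (q ^_) (sym (m∸n+n≡m i≤j)) ⟩
  q ^ (j ∸ i + i)   ≡⟨ ^-distribˡ-+-* q (j ∸ i) i ⟩
  q ^ (j ∸ i) * q ^ i ∎)
  where open ≡-Reasoning

∣∧<⇒≡0 : ∀ {m d} → m ∣ d → d < m → d ≡ 0
∣∧<⇒≡0 {d = zero}  _   _   = refl
∣∧<⇒≡0 {d = suc _} m∣d d<m = contradiction (∣⇒≤ m∣d) (<⇒≱ d<m)

halve : ∀ {y m} → 2 * y ≤ 2 * m + 1 → y ≤ m
halve {y} {m} 2y≤2m+1 = s≤s⁻¹ (*-cancelˡ-< 2 y (suc m) (begin-strict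
  2 * y       ≤⟨ 2y≤2m+1 ⟩
  2 * m + 1   <⟨ +-monoʳ-< (2 * m) (n<1+n 1) ⟩
  2 * m + 2   ≡⟨ +-comm (2 * m) 2 ⟩
  2 + 2 * m   ≡⟨ *-suc 2 m ⟨
  2 * suc m   ∎))
  where open ≤-Reasoning

*[2p+1]≤3*[*p] : ∀ k {p} → 1 ≤ p → k * (2 * p + 1) ≤ 3 * (k * p)
*[2p+1]≤3*[*p] k {p} 1≤p = begin
  k * (2 * p + 1)   ≤⟨ *-monoʳ-≤ k (+-monoʳ-≤ (2 * p) 1≤p) ⟩
  k * (2 * p + p)   ≡⟨ rearrange k p ⟩
  3 * (k * p)       ∎
  where
  open ≤-Reasoning
  rearrange : ∀ k p → k * (2 * p + p) ≡ 3 * (k * p)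
  rearrange = solve-∀

coprime-*ʳ : ∀ {a b c} → Coprime a b → Coprime a c → Coprime a (b * c)
coprime-*ʳ a⊥b a⊥c (i∣a , i∣bc) = a⊥c (i∣a , coprime-divisor i⊥b i∣bc)
  where
  i⊥b : Coprime _ _
  i⊥b (k∣i , k∣b) = a⊥b (∣-trans k∣i i∣a , k∣b)

coprime-^ʳ : ∀ {a b} → Coprime a b → ∀ k → Coprime a (b ^ k)
coprime-^ʳ a⊥b zero    (_ , i∣1) = ∣1⇒≡1 i∣1
coprime-^ʳ a⊥b (suc k) = coprime-*ʳ a⊥b (coprime-^ʳ a⊥b k)

∤⇒coprime : ∀ {q a} → Prime q → ¬ q ∣ a → Coprime a q
∤⇒coprime q-prime q∤a (i∣a , i∣q) with prime⇒irreducible q-prime i∣q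
... | inj₁ i≡1 = i≡1
... | inj₂ refl = contradiction i∣a q∤a

coprime⇒*∣ : ∀ {m n t} → Coprime m n → m ∣ t → n ∣ t → m * n ∣ t
coprime⇒*∣ {m} {n} m⊥n (divides k refl) n∣km =
  subst (m * n ∣_) (*-comm m k) (*-monoʳ-∣ m (coprime-divisor (Coprimality.sym m⊥n) (subst (n ∣_) (*-comm k m) n∣km)))

primeDivisor : ∀ m → 1 < m → ∃ λ q → Prime q × q ∣ m
primeDivisor m 1<m = firstFactor factors isFactorisation factorsPrime
  where
  instance
    m≢0 : NonZero m
    m≢0 = >-nonZero (<-trans z<s 1<m)
  open PrimeFactorisation (factorise m)
  firstFactor : ∀ qs → m ≡ product qs → All Prime qs → ∃ λ q → Prime q × q ∣ m
  firstFactor []       refl _           = contradiction 1<m (<-irrefl refl)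
  firstFactor (q ∷ qs) refl (q-prime ∷ _) = q , q-prime , divides (product qs) (*-comm q _)

prime⇒1< : ∀ {q} → Prime q → 1 < q
prime⇒1< {q} q-prime = nonTrivial⇒n>1 q {{prime⇒nonTrivial q-prime}}

factorOut : ∀ {q} → Prime q → ∀ e → 0 < e → ∃₂ λ j e′ → e ≡ q ^ j * e′ × ¬ q ∣ e′
factorOut {q} q-prime = <-rec _ go
  where
  go : ∀ e → (∀ {e₁} → e₁ < e → 0 < e₁ → ∃₂ λ j e′ → e₁ ≡ q ^ j * e′ × ¬ q ∣ e′) →
       0 < e → ∃₂ λ j e′ → e ≡ q ^ j * e′ × ¬ q ∣ e′
  go e rec 0<e with q ∣? e
  ... | no q∤e = 0 , e , sym (*-identityˡ e) , q∤e
  ... | yes (divides e₁ refl) with rec e₁<e₁*q 0<e₁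
    where
    0<e₁ : 0 < e₁
    0<e₁ = n≢0⇒n>0 λ { refl → <-irrefl refl 0<e }
    e₁<e₁*q : e₁ < e₁ * q
    e₁<e₁*q = m<m*n e₁ q {{>-nonZero 0<e₁}} (prime⇒1< q-prime)
  ...   | j , e′ , e₁≡ , q∤e′ = suc j , e′ , trans (cong (_* q) e₁≡) (rearrange q (q ^ j) e′) , q∤e′
    where
    rearrange : ∀ q x e → x * e * q ≡ q * x * e
    rearrange = solve-∀

<-cofactor : ∀ {c m′} → 1 < c → 0 < c * m′ → 0 < m′ × m′ < c * m′
<-cofactor {c} {zero}    _   0<c*0 = contradiction (subst (0 <_) (*-zeroʳ c) 0<c*0) (<-irrefl refl)
<-cofactor {c} {suc m′} 1<c _     = z<s , subst (suc m′ <_) (*-comm (suc m′) c) (m<m*n (suc m′) c 1<c)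

∤-cofactor : ∀ {q m′ e i j e′} → Prime q → ¬ q ∣ m′ → i ≤ j → e ≡ q ^ j * e′ →
             ¬ q ^ i * m′ ∣ e → ¬ m′ ∣ e
∤-cofactor {q} {m′} {j = j} q-prime q∤m′ i≤j e≡ ∤e m′∣e =
  ∤e (subst (_ ∣_) (sym e≡) (*-pres-∣ (^-monoʳ-∣ q i≤j) m′∣e′))
  where
  m′∣e′ : m′ ∣ _
  m′∣e′ = coprime-divisor (coprime-^ʳ (∤⇒coprime q-prime q∤m′) j) (subst (m′ ∣_) e≡ m′∣e)

excessPrimePower : ∀ m {e} → 0 < m → 0 < e → ¬ m ∣ e →
  ∃ λ q → ∃₂ λ j e′ → Prime q × e ≡ q ^ j * e′ × ¬ q ∣ e′ × q ^ suc j ∣ m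
excessPrimePower m {e} 0<m 0<e = <-rec Goal go m 0<m
  where
  Goal : ℕ → Set
  Goal m = 0 < m → ¬ m ∣ e → ∃ λ q → ∃₂ λ j e′ → Prime q × e ≡ q ^ j * e′ × ¬ q ∣ e′ × q ^ suc j ∣ m
  go : ∀ m → (∀ {k} → k < m → Goal k) → Goal m
  go (suc zero) _ _ 1∤e = contradiction (1∣ e) 1∤e
  go m@(suc (suc _)) rec 0<m m∤e with primeDivisor m (s≤s (s≤s z≤n))
  ... | q , q-prime , q∣m with factorOut q-prime e 0<e | factorOut q-prime m 0<m
  ... | j , e′ , e≡ , q∤e′ | zero , m′ , m≡ , q∤m′ =
    contradiction (subst (q ∣_) (trans m≡ (*-identityˡ m′)) q∣m) q∤m′
  ... | j , e′ , e≡ , q∤e′ | suc i , m′ , m≡ , q∤m′ with j <? suc i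
  ...   | yes j<i = q , j , e′ , q-prime , e≡ , q∤e′ , ∣-trans (^-monoʳ-∣ q j<i) (divides m′ (trans m≡ (*-comm _ m′)))
  ...   | no j≮i =
    let 0<m′ , m′<m = <-cofactor (^-monoʳ-< q (prime⇒1< q-prime) (z<s {n = i})) (subst (0 <_) m≡ 0<m)
        q₂ , j₂ , e₂ , q₂-prime , e≡₂ , q₂∤e₂ , q₂∣m′ =
          rec (subst (m′ <_) (sym m≡) m′<m) 0<m′
              (∤-cofactor q-prime q∤m′ (≮⇒≥ j≮i) e≡ (subst (λ k → ¬ k ∣ e) m≡ m∤e))
    in q₂ , j₂ , e₂ , q₂-prime , e≡₂ , q₂∤e₂ , ∣-trans q₂∣m′ (divides (q ^ suc i) m≡)

-- Primitive roots modulo a prime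

module Residues (p : ℕ) .{{_ : NonZero p}} where

  infix 4 _≈_
  _≈_ : ℕ → ℕ → Set
  a ≈ b = a % p ≡ b % p

  *-cong : ∀ {a a′ b b′} → a ≈ a′ → b ≈ b′ → a * b ≈ a′ * b′
  *-cong {a} {a′} {b} {b′} a≈a′ b≈b′ = begin
    a * b % p               ≡⟨ %-distribˡ-* a b p ⟩
    (a % p) * (b % p) % p   ≡⟨ cong₂ (λ x y → x * y % p) a≈a′ b≈b′ ⟩
    (a′ % p) * (b′ % p) % p ≡⟨ %-distribˡ-* a′ b′ p ⟨
    a′ * b′ % p             ∎
    where open ≡-Reasoning

  ^-cong : ∀ {a b} t → a ≈ b → a ^ t ≈ b ^ t
  ^-cong zero    _   = refl
  ^-cong (suc t) a≈b = *-cong a≈b (^-cong t a≈b)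

  ^≈1 : ∀ {a} t → a ≈ 1 → a ^ t ≈ 1
  ^≈1 t a≈1 = trans (^-cong t a≈1) (cong (_% p) (^-zeroˡ t))

  %≈ : ∀ a → a % p ≈ a
  %≈ a = m%n%n≡m%n a p

  ≈⇒∣∸ : ∀ {x y} → y ≤ x → x ≈ y → p ∣ x ∸ y
  ≈⇒∣∸ {x} {y} y≤x x≈y = divides (x / p ∸ y / p) (begin
    x ∸ y                                  ≡⟨ cong₂ _∸_ (m≡m%n+[m/n]*n x p) (m≡m%n+[m/n]*n y p) ⟩
    (x % p + x / p * p) ∸ (y % p + y / p * p) ≡⟨ cong (λ r → (x % p + x / p * p) ∸ (r + y / p * p)) (sym x≈y) ⟩
    (x % p + x / p * p) ∸ (x % p + y / p * p) ≡⟨ [m+n]∸[m+o]≡n∸o (x % p) _ _ ⟩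
    x / p * p ∸ y / p * p                  ≡⟨ *-distribʳ-∸ p (x / p) (y / p) ⟨
    (x / p ∸ y / p) * p                    ∎)
    where open ≡-Reasoning

  ∣∸⇒≈ : ∀ {x y} → y ≤ x → p ∣ x ∸ y → x ≈ y
  ∣∸⇒≈ {x} {y} y≤x (divides k x∸y≡) = begin
    x % p             ≡⟨ cong (_% p) (m+[n∸m]≡n y≤x) ⟨
    (y + (x ∸ y)) % p ≡⟨ cong (λ z → (y + z) % p) x∸y≡ ⟩
    (y + k * p) % p   ≡⟨ [m+kn]%n≡m%n y k p ⟩
    y % p             ∎
    where open ≡-Reasoning

  ∣∧window⇒≡ : ∀ {t} → 0 < t → t < p + p → p ∣ t → t ≡ p
  ∣∧window⇒≡ 0<t _     (divides zero          t≡0)  = contradiction (sym t≡0) (<⇒≢ 0<t)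
  ∣∧window⇒≡ _   _     (divides (suc zero)    t≡p)  = trans t≡p (+-identityʳ p)
  ∣∧window⇒≡ _   t<2p  (divides (suc (suc q)) t≡)   =
    contradiction (subst (p + p ≤_) (sym t≡) (+-monoʳ-≤ p (m≤m+n p (q * p)))) (<⇒≱ t<2p)

  ∣+∸⇔%≡ : ∀ S {a} → a < p → p ∣ S + (p ∸ a) ⇔ S % p ≡ a
  ∣+∸⇔%≡ S {a} a<p = mk⇔ ⇒%≡ ⇒∣
    where
    open ≡-Reasoning
    r = S % p
    c = p ∸ a
    a+c≡p : a + c ≡ p
    a+c≡p = m+[n∸m]≡n (<⇒≤ a<p)
    split : S + c ≡ (S / p) * p + (r + c)
    split = begin
      S + c                   ≡⟨ cong (_+ c) (m≡m%n+[m/n]*n S p) ⟩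
      r + (S / p) * p + c     ≡⟨ cong (_+ c) (+-comm r _) ⟩
      (S / p) * p + r + c     ≡⟨ +-assoc ((S / p) * p) r c ⟩
      (S / p) * p + (r + c)   ∎
    ⇒%≡ : p ∣ S + c → r ≡ a
    ⇒%≡ p∣S+c = +-cancelʳ-≡ c r a (trans r+c≡p (sym a+c≡p))
      where
      p∣r+c : p ∣ r + c
      p∣r+c = ∣m+n∣m⇒∣n (subst (p ∣_) split p∣S+c) (n∣m*n (S / p))
      r+c≡p : r + c ≡ p
      r+c≡p = ∣∧window⇒≡ (<-≤-trans (m<n⇒0<n∸m a<p) (m≤n+m c r)) (+-mono-<-≤ (m%n<n S p) (m∸n≤m p a)) p∣r+c
    ⇒∣ : r ≡ a → p ∣ S + c
    ⇒∣ r≡a = subst (p ∣_) (sym split)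
      (∣m∣n⇒∣m+n (n∣m*n (S / p)) (subst (p ∣_) (sym (trans (cong (_+ c) r≡a) a+c≡p)) ∣-refl))

module MonicPolynomials where

  open import Data.Integer.Base using (+_)
  open +-*-Solver

  -- c₀ ∷ c₁ ∷ … ∷ c_(d−1) ∷ [] stands for the monic polynomial c₀ + c₁x + … + x^d.
  evalMonic : List ℤ → ℤ → ℤ
  evalMonic []       x = ℤ.1ℤ
  evalMonic (c ∷ cs) x = c ℤ.+ x ℤ.* evalMonic cs x

  quotientAt : ℤ → List ℤ → List ℤ
  quotientAt r []        = []
  quotientAt r (c ∷ cs) = evalMonic (c ∷ cs) r ∷ quotientAt r cs

  length-quotientAt : ∀ r cs → length (quotientAt r cs) ≡ length cs
  length-quotientAt r []       = refl
  length-quotientAt r (c ∷ cs) = cong suc (length-quotientAt r cs)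

  evalMonic-division : ∀ r c cs x →
    evalMonic (c ∷ cs) x ≡ (x ℤ.- r) ℤ.* evalMonic (quotientAt r cs) x ℤ.+ evalMonic (c ∷ cs) r
  evalMonic-division r c []        x = base r c x
    where
    base : ∀ r c x → c ℤ.+ x ℤ.* ℤ.1ℤ ≡ (x ℤ.- r) ℤ.* ℤ.1ℤ ℤ.+ (c ℤ.+ r ℤ.* ℤ.1ℤ)
    base = solve 3 (λ r c x → c :+ x :* con ℤ.1ℤ := (x :- r) :* con ℤ.1ℤ :+ (c :+ r :* con ℤ.1ℤ)) refl
  evalMonic-division r c (c′ ∷ cs) x rewrite evalMonic-division r c′ cs x =
    step c x r (evalMonic (quotientAt r cs) x) (evalMonic (c′ ∷ cs) r)
    where
    step : ∀ c x r Q R → c ℤ.+ x ℤ.* ((x ℤ.- r) ℤ.* Q ℤ.+ R) ≡ (x ℤ.- r) ℤ.* (R ℤ.+ x ℤ.* Q) ℤ.+ (c ℤ.+ r ℤ.* R)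
    step = solve 5 (λ c x r Q R → c :+ x :* ((x :- r) :* Q :+ R) := (x :- r) :* (R :+ x :* Q) :+ (c :+ r :* R)) refl

  evalMonic-zeros : ∀ k v → evalMonic (replicate k ℤ.0ℤ) (+ v) ≡ + (v ^ k)
  evalMonic-zeros zero    v = refl
  evalMonic-zeros (suc k) v =
    trans (ℤ.+-identityˡ _) (trans (cong (+ v ℤ.*_) (evalMonic-zeros k v)) (sym (ℤ.pos-* v (v ^ k))))

  evalMonic-x^e-1 : ∀ k v → evalMonic (ℤ.-1ℤ ∷ replicate k ℤ.0ℤ) (+ v) ≡ + (v ^ suc k) ℤ.- ℤ.1ℤ
  evalMonic-x^e-1 k v = trans (ℤ.+-comm ℤ.-1ℤ (+ v ℤ.* evalMonic (replicate k ℤ.0ℤ) (+ v)))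
    (cong (ℤ._- ℤ.1ℤ) (trans (cong (+ v ℤ.*_) (evalMonic-zeros k v)) (sym (ℤ.pos-* v (v ^ k)))))

  module _ {p} (p-prime : Prime p) where

    euclidℤ : ∀ a b → + p ∣ℤ a ℤ.* b → + p ∣ℤ a ⊎ + p ∣ℤ b
    euclidℤ a b p∣ab = Sum.map ∣ᵤ⇒∣ ∣ᵤ⇒∣
      (euclidsLemma ℤ.∣ a ∣ ℤ.∣ b ∣ p-prime (subst (p ∣_) (ℤ.abs-* a b) (∣⇒∣ᵤ p∣ab)))

    ∤1 : ¬ + p ∣ℤ ℤ.1ℤ
    ∤1 p∣1 = <⇒≱ (prime⇒1< p-prime) (∣⇒≤ (∣⇒∣ᵤ p∣1))

    root-of-quotient : ∀ {r s c cs} → ¬ + p ∣ℤ s ℤ.- r →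
      + p ∣ℤ evalMonic (c ∷ cs) r → + p ∣ℤ evalMonic (c ∷ cs) s → + p ∣ℤ evalMonic (quotientAt r cs) s
    root-of-quotient {r} {s} {c} {cs} p∤s-r p∣f[r] p∣f[s] =
      Sum.[ (λ p∣s-r → contradiction p∣s-r p∤s-r) , id ]′ (euclidℤ (s ℤ.- r) (evalMonic (quotientAt r cs) s) p∣product)
      where
      cancelRemainder : ∀ A Q R → A ℤ.* Q ℤ.+ R ℤ.- R ≡ A ℤ.* Q
      cancelRemainder = solve 3 (λ A Q R → A :* Q :+ R :- R := A :* Q) refl
      p∣product : + p ∣ℤ (s ℤ.- r) ℤ.* evalMonic (quotientAt r cs) s
      p∣product = subst (+ p ∣ℤ_)
        (trans (cong (ℤ._- evalMonic (c ∷ cs) r) (evalMonic-division r c cs s))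
                (cancelRemainder (s ℤ.- r) (evalMonic (quotientAt r cs) s) (evalMonic (c ∷ cs) r)))
        (∣m∣n⇒∣m-n p∣f[s] p∣f[r])

    rootBound : ∀ cs {rs} → AllPairs (λ r s → ¬ + p ∣ℤ s ℤ.- r) rs →
                All (λ r → + p ∣ℤ evalMonic cs r) rs → length rs ≤ length cs
    rootBound cs       {[]}     _                  _                  = z≤n
    rootBound []       {r ∷ _}  _                  (p∣1 ∷ _)          = contradiction p∣1 ∤1
    rootBound (c ∷ cs) {r ∷ rs} (r≉rs ∷ distinct) (p∣f[r] ∷ p∣f[rs]) =
      s≤s (subst (length rs ≤_) (length-quotientAt r cs)
        (rootBound (quotientAt r cs) distinct
          (All.zipWith (λ (p∤s-r , p∣f[s]) → root-of-quotient {c = c} {cs} p∤s-r p∣f[r] p∣f[s]) (r≉rs , p∣f[rs]))))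

module RootsOfUnity {p} (p-prime : Prime p) where

  open import Data.Integer.Base using (+_)

  private instance
    p≢0 : NonZero p
    p≢0 = prime⇒nonZero p-prime

  open Residues p
  open +-*-Solver

  ≈⇒∣ℤ- : ∀ {a b} → a ≈ b → + p ∣ℤ + a ℤ.- + b
  ≈⇒∣ℤ- {a} {b} a≈b = dividesℤ (+ (a / p) ℤ.- + (b / p)) (begin
      + a ℤ.- + b
    ≡⟨ cong₂ ℤ._-_ (split a) (split b) ⟩
      (+ (a % p) ℤ.+ + (a / p) ℤ.* + p) ℤ.- (+ (b % p) ℤ.+ + (b / p) ℤ.* + p)
    ≡⟨ cong (λ r → (+ (a % p) ℤ.+ + (a / p) ℤ.* + p) ℤ.- (+ r ℤ.+ + (b / p) ℤ.* + p)) (sym a≈b) ⟩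
      (+ (a % p) ℤ.+ + (a / p) ℤ.* + p) ℤ.- (+ (a % p) ℤ.+ + (b / p) ℤ.* + p)
    ≡⟨ cancel (+ (a % p)) (+ (a / p)) (+ (b / p)) (+ p) ⟩
      (+ (a / p) ℤ.- + (b / p)) ℤ.* + p ∎)
    where
    open ≡-Reasoning
    split : ∀ x → + x ≡ + (x % p) ℤ.+ + (x / p) ℤ.* + p
    split x = trans (cong +_ (m≡m%n+[m/n]*n x p))
      (trans (ℤ.pos-+ (x % p) _) (cong (ℤ._+_ (+ (x % p))) (ℤ.pos-* (x / p) p)))
    cancel : ∀ r x y q → (r ℤ.+ x ℤ.* q) ℤ.- (r ℤ.+ y ℤ.* q) ≡ (x ℤ.- y) ℤ.* q
    cancel = solve 4 (λ r x y q → (r :+ x :* q) :- (r :+ y :* q) := (x :- y) :* q) refl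

  ≢⇒∤ℤ- : ∀ {a b} → a < p → b < p → a ≢ b → ¬ + p ∣ℤ + a ℤ.- + b
  ≢⇒∤ℤ- {a} {b} a<p b<p a≢b p∣a-b = >⇒∤ {{≢-nonZero diff≢0}} diff<p (∣⇒∣ᵤ p∣a-b)
    where
    diff≢0 : ℤ.∣ + a ℤ.- + b ∣ ≢ 0
    diff≢0 = a≢b ∘ ℤ.+-injective ∘ ℤ.i-j≡0⇒i≡j (+ a) (+ b) ∘ ℤ.∣i∣≡0⇒i≡0
    diff<p : ℤ.∣ + a ℤ.- + b ∣ < p
    diff<p = subst (_< p) (cong ℤ.∣_∣ (sym (ℤ.m-n≡m⊖n a b))) (≤-<-trans (ℤ.∣m⊝n∣≤m⊔n a b) (⊔-lub a<p b<p))

  rootsOfUnity-bound : ∀ {e} → 0 < e → (∀ {v} → 0 < v → v < p → v ^ e ≈ 1) → p ∸ 1 ≤ e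
  rootsOfUnity-bound {suc k} _ roots = subst₂ _≤_ (length-applyUpTo _ (p ∸ 1)) (cong suc (length-replicate k))
    (MonicPolynomials.rootBound p-prime (ℤ.-1ℤ ∷ replicate k ℤ.0ℤ) distinct allRoots)
    where
    open MonicPolynomials using (evalMonic; evalMonic-x^e-1)
    candidates : List ℤ
    candidates = applyUpTo (λ i → + suc i) (p ∸ 1)
    distinct : AllPairs (λ r s → ¬ + p ∣ℤ s ℤ.- r) candidates
    distinct = AllPairs.applyUpTo⁺₁ _ (p ∸ 1) λ i<j j<N →
      ≢⇒∤ℤ- (m≤pred[n]⇒suc[m]≤n j<N) (m≤pred[n]⇒suc[m]≤n (<-trans i<j j<N)) (λ e → <-irrefl (sym (cong pred e)) i<j)
    allRoots : All (λ r → + p ∣ℤ evalMonic (ℤ.-1ℤ ∷ replicate k ℤ.0ℤ) r) candidates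
    allRoots = applyUpTo⁺₁ _ (p ∸ 1) λ {i} i<N →
      subst (+ p ∣ℤ_) (sym (evalMonic-x^e-1 k (suc i))) (≈⇒∣ℤ- (roots z<s (m≤pred[n]⇒suc[m]≤n i<N)))


module PrimeModulus (p : ℕ) (p-prime : Prime p) where

  instance
    p≢0 : NonZero p
    p≢0 = prime⇒nonZero p-prime

  open Residues p public

  N : ℕ
  N = p ∸ 1

  1<p : 1 < p
  1<p = prime⇒1< p-prime

  0<N : 0 < N
  0<N = pred-mono-< 1<p

  ∤-* : ∀ {a b} → ¬ p ∣ a → ¬ p ∣ b → ¬ p ∣ a * b
  ∤-* p∤a p∤b p∣ab with euclidsLemma _ _ p-prime p∣ab
  ... | inj₁ p∣a = p∤a p∣a
  ... | inj₂ p∣b = p∤b p∣b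

  ∤-^ : ∀ {a} → ¬ p ∣ a → ∀ t → ¬ p ∣ a ^ t
  ∤-^ p∤a zero    p∣1 = <⇒≱ 1<p (∣⇒≤ p∣1)
  ∤-^ p∤a (suc t) = ∤-* p∤a (∤-^ p∤a t)

  0<v<p⇒∤ : ∀ {v} → 0 < v → v < p → ¬ p ∣ v
  0<v<p⇒∤ 0<v = >⇒∤ {{>-nonZero 0<v}}

  ∤⇒0<% : ∀ {a} → ¬ p ∣ a → 0 < a % p
  ∤⇒0<% {a} p∤a = n≢0⇒n>0 (p∤a ∘ m%n≡0⇒n∣m a p)

  private
    *-cancelˡ-≈-≤ : ∀ {c x y} → ¬ p ∣ c → y ≤ x → c * x ≈ c * y → x ≈ y
    *-cancelˡ-≈-≤ {c} {x} {y} p∤c y≤x cx≈cy with euclidsLemma c (x ∸ y) p-prime p∣c[x∸y]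
      where
      p∣c[x∸y] : p ∣ c * (x ∸ y)
      p∣c[x∸y] = subst (p ∣_) (sym (*-distribˡ-∸ c x y)) (≈⇒∣∸ (*-monoʳ-≤ c y≤x) cx≈cy)
    ... | inj₁ p∣c   = contradiction p∣c p∤c
    ... | inj₂ p∣x∸y = ∣∸⇒≈ y≤x p∣x∸y

  *-cancelˡ-≈ : ∀ {c x y} → ¬ p ∣ c → c * x ≈ c * y → x ≈ y
  *-cancelˡ-≈ {x = x} {y} p∤c cx≈cy with ≤-total y x
  ... | inj₁ y≤x = *-cancelˡ-≈-≤ p∤c y≤x cx≈cy
  ... | inj₂ x≤y = sym (*-cancelˡ-≈-≤ p∤c x≤y (sym cx≈cy))

  N<p : N < p
  N<p = m≤pred[n]⇒suc[m]≤n ≤-refl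

  unitIndex : ∀ a → ¬ p ∣ a → Fin N
  unitIndex a p∤a = fromℕ< (pred-mono-< {{>-nonZero (∤⇒0<% p∤a)}} (m%n<n a p))

  unitIndex-injective : ∀ {a b} (p∤a : ¬ p ∣ a) (p∤b : ¬ p ∣ b) → unitIndex a p∤a ≡ unitIndex b p∤b → a ≈ b
  unitIndex-injective p∤a p∤b same =
    pred-injective {{>-nonZero (∤⇒0<% p∤a)}} {{>-nonZero (∤⇒0<% p∤b)}} (fromℕ<-injective _ _ _ _ same)

  record _HasOrder_ (a m : ℕ) : Set where
    field
      ∣⇒^≈1 : ∀ {t} → m ∣ t → a ^ t ≈ 1
      ^≈1⇒∣ : ∀ {t} → a ^ t ≈ 1 → m ∣ t
  open _HasOrder_ public

  hasOrder-unique : ∀ {a m n} → a HasOrder m → a HasOrder n → m ≡ n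
  hasOrder-unique oₘ oₙ = ∣-antisym (^≈1⇒∣ oₘ (∣⇒^≈1 oₙ ∣-refl)) (^≈1⇒∣ oₙ (∣⇒^≈1 oₘ ∣-refl))

  hasOrder-cong : ∀ {a b m} → a ≈ b → a HasOrder m → b HasOrder m
  hasOrder-cong a≈b o = record
    { ∣⇒^≈1 = λ {t} m∣t → trans (sym (^-cong t a≈b)) (∣⇒^≈1 o m∣t)
    ; ^≈1⇒∣ = λ {t} b^t≈1 → ^≈1⇒∣ o {t} (trans (^-cong t a≈b) b^t≈1)
    }

  hasOrder-^ : ∀ {a} u {v} .{{_ : NonZero u}} → a HasOrder (u * v) → (a ^ u) HasOrder v
  hasOrder-^ {a} u o = record
    { ∣⇒^≈1 = λ {t} v∣t → trans (cong (_% p) (^-*-assoc a u t)) (∣⇒^≈1 o (*-monoʳ-∣ u v∣t))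
    ; ^≈1⇒∣ = λ {t} a^ut≈1 → *-cancelˡ-∣ u (^≈1⇒∣ o (trans (cong (_% p) (sym (^-*-assoc a u t))) a^ut≈1))
    }

  ^≈1-cancelʳ : ∀ {a b t} → b ^ t ≈ 1 → (a * b) ^ t ≈ 1 → a ^ t ≈ 1
  ^≈1-cancelʳ {a} {b} {t} b^t≈1 ab^t≈1 = begin
    a ^ t % p         ≡⟨ cong (_% p) (*-identityʳ (a ^ t)) ⟨
    a ^ t * 1 % p     ≡⟨ *-cong {a ^ t} refl b^t≈1 ⟨
    a ^ t * b ^ t % p ≡⟨ cong (_% p) (^-distribʳ-* a b t) ⟨
    (a * b) ^ t % p   ≡⟨ ab^t≈1 ⟩
    1 % p             ∎
    where open ≡-Reasoning

  hasOrder-* : ∀ {a b m n} → Coprime m n → a HasOrder m → b HasOrder n → (a * b) HasOrder (m * n)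
  hasOrder-* {a} {b} {m} {n} m⊥n oₐ o_b = record { ∣⇒^≈1 = ∣⇒^≈1′ ; ^≈1⇒∣ = ^≈1⇒∣′ }
    where
    ∣⇒^≈1′ : ∀ {t} → m * n ∣ t → (a * b) ^ t ≈ 1
    ∣⇒^≈1′ {t} mn∣t = trans (cong (_% p) (^-distribʳ-* a b t))
      (*-cong (∣⇒^≈1 oₐ (∣-trans (m∣m*n n) mn∣t)) (∣⇒^≈1 o_b (∣-trans (n∣m*n m) mn∣t)))
    eliminate : ∀ {x y k t} → y HasOrder k → (x * y) ^ t ≈ 1 → x ^ (k * t) ≈ 1
    eliminate {x} {y} {k} {t} oy xy^t≈1 = ^≈1-cancelʳ {x} {y} {k * t} (∣⇒^≈1 oy (m∣m*n t)) (begin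
      (x * y) ^ (k * t) % p   ≡⟨ cong (λ e → (x * y) ^ e % p) (*-comm k t) ⟩
      (x * y) ^ (t * k) % p   ≡⟨ cong (_% p) (^-*-assoc (x * y) t k) ⟨
      ((x * y) ^ t) ^ k % p   ≡⟨ ^≈1 k xy^t≈1 ⟩
      1 % p                   ∎)
      where open ≡-Reasoning
    ^≈1⇒∣′ : ∀ {t} → (a * b) ^ t ≈ 1 → m * n ∣ t
    ^≈1⇒∣′ {t} ab^t≈1 = coprime⇒*∣ m⊥n
      (coprime-divisor m⊥n (^≈1⇒∣ oₐ {n * t} (eliminate {a} {b} {n} {t} o_b ab^t≈1)))
      (coprime-divisor (Coprimality.sym m⊥n)
        (^≈1⇒∣ o_b {m * t} (eliminate {b} {a} {m} {t} oₐ (subst (λ x → x ^ t ≈ 1) (*-comm a b) ab^t≈1))))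

  hasOrder⇒∤ : ∀ {a m} → 0 < m → a HasOrder m → ¬ p ∣ a
  hasOrder⇒∤ {a} {suc k} _ o p∣a = 0≢1+n (begin
    0                 ≡⟨ n∣m⇒m%n≡0 _ p (∣m⇒∣m*n (a ^ k) p∣a) ⟨
    a ^ suc k % p     ≡⟨ ∣⇒^≈1 o ∣-refl ⟩
    1 % p             ≡⟨ m<n⇒m%n≡m 1<p ⟩
    1                 ∎)
    where open ≡-Reasoning

  leastPeriod⇒hasOrder : ∀ {a m} → 0 < m → a ^ m ≈ 1 → (∀ {k} → k < m → ¬ (0 < k × a ^ k ≈ 1)) →
                         a HasOrder m
  leastPeriod⇒hasOrder {a} {m} 0<m a^m≈1 least = record { ∣⇒^≈1 = ∣⇒^≈1′ ; ^≈1⇒∣ = ^≈1⇒∣′ }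
    where
    instance
      m≢0 : NonZero m
      m≢0 = >-nonZero 0<m
    ∣⇒^≈1′ : ∀ {t} → m ∣ t → a ^ t ≈ 1
    ∣⇒^≈1′ (divides q refl) =
      trans (cong (_% p) (trans (cong (a ^_) (*-comm q m)) (sym (^-*-assoc a m q)))) (^≈1 q a^m≈1)
    ^≈1⇒∣′ : ∀ {t} → a ^ t ≈ 1 → m ∣ t
    ^≈1⇒∣′ {t} a^t≈1 with t % m ≟ 0
    ... | yes r≡0 = m%n≡0⇒n∣m t m r≡0
    ... | no  r≢0 = contradiction (n≢0⇒n>0 r≢0 , a^r≈1) (least (m%n<n t m))
      where
      open ≡-Reasoning
      r = t % m
      q = t / m
      a^r≈1 : a ^ r ≈ 1
      a^r≈1 = begin
        a ^ r % p               ≡⟨ cong (_% p) (*-identityʳ (a ^ r)) ⟨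
        a ^ r * 1 % p           ≡⟨ *-cong {a ^ r} refl (^≈1 q a^m≈1) ⟨
        a ^ r * (a ^ m) ^ q % p ≡⟨ cong (λ e → a ^ r * e % p) (^-*-assoc a m q) ⟩
        a ^ r * a ^ (m * q) % p ≡⟨ cong (_% p) (^-distribˡ-+-* a r (m * q)) ⟨
        a ^ (r + m * q) % p     ≡⟨ cong (λ e → a ^ (r + e) % p) (*-comm m q) ⟩
        a ^ (r + q * m) % p     ≡⟨ cong (λ e → a ^ e % p) (m≡m%n+[m/n]*n t m) ⟨
        a ^ t % p               ≡⟨ a^t≈1 ⟩
        1 % p                   ∎

  ^≈^⇒^∸≈1 : ∀ {a i j} → ¬ p ∣ a → i ≤ j → a ^ i ≈ a ^ j → a ^ (j ∸ i) ≈ 1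
  ^≈^⇒^∸≈1 {a} {i} {j} p∤a i≤j a^i≈a^j = *-cancelˡ-≈ (∤-^ p∤a i) (begin
    a ^ i * a ^ (j ∸ i) % p ≡⟨ cong (_% p) (^-distribˡ-+-* a i (j ∸ i)) ⟨
    a ^ (i + (j ∸ i)) % p   ≡⟨ cong (λ e → a ^ e % p) (m+[n∸m]≡n i≤j) ⟩
    a ^ j % p               ≡⟨ a^i≈a^j ⟨
    a ^ i % p               ≡⟨ cong (_% p) (*-identityʳ (a ^ i)) ⟨
    a ^ i * 1 % p           ∎)
    where open ≡-Reasoning

  powers-cycle : ∀ {a} → ¬ p ∣ a → ∃ λ d → 0 < d × d ≤ N × a ^ d ≈ 1
  powers-cycle {a} p∤a with pigeonhole N<p (λ i → unitIndex (a ^ toℕ i) (∤-^ p∤a (toℕ i)))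
  ... | i , j , i<j , same =
    toℕ j ∸ toℕ i , m<n⇒0<n∸m i<j , ≤-trans (m∸n≤m (toℕ j) (toℕ i)) (<⇒≤pred (toℕ<n j)) ,
    ^≈^⇒^∸≈1 p∤a (<⇒≤ i<j) (unitIndex-injective (∤-^ p∤a (toℕ i)) (∤-^ p∤a (toℕ j)) same)

  hasOrder-exists : ∀ {a} → ¬ p ∣ a → ∃ λ m → 0 < m × m ≤ N × a HasOrder m
  hasOrder-exists {a} p∤a =
    let d , 0<d , d≤N , a^d≈1 = powers-cycle p∤a
        m , m≤d , (0<m , a^m≈1) , least =
          leastWitness (λ k → 0 <? k ×-dec (a ^ k % p ≟ 1 % p)) (0<d , a^d≈1)
    in m , 0<m , ≤-trans m≤d d≤N , leastPeriod⇒hasOrder 0<m a^m≈1 least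

  orderOf : ℕ → ℕ
  orderOf a with p ∣? a
  ... | yes _   = 0
  ... | no  p∤a = proj₁ (hasOrder-exists p∤a)

  orderOf-spec : ∀ {a} → ¬ p ∣ a → 0 < orderOf a × orderOf a ≤ N × a HasOrder orderOf a
  orderOf-spec {a} p∤a with p ∣? a
  ... | yes p∣a = contradiction p∣a p∤a
  ... | no  p∤a = proj₂ (hasOrder-exists p∤a)

  maxOrderUnit : ℕ
  maxOrderUnit = argmax orderOf 1 (applyUpTo suc N)

  maxOrderUnit-∤ : ¬ p ∣ maxOrderUnit
  maxOrderUnit-∤ = argmax-all orderOf {P = λ v → ¬ p ∣ v}
    (0<v<p⇒∤ z<s 1<p) (applyUpTo⁺₁ suc N (λ i<N → 0<v<p⇒∤ z<s (m≤pred[n]⇒suc[m]≤n i<N)))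

  orderOf≤maxOrder : ∀ {v} → 0 < v → v < p → orderOf v ≤ orderOf maxOrderUnit
  orderOf≤maxOrder {suc i} _ v<p = applyUpTo⁻ suc N (f[xs]≤f[argmax] {f = orderOf} 1 (applyUpTo suc N)) (<⇒≤pred v<p)

  hasOrder⇒≤maxOrder : ∀ {c k} → 0 < k → c HasOrder k → k ≤ orderOf maxOrderUnit
  hasOrder⇒≤maxOrder {c} 0<k o = subst (_≤ _) order≡k (orderOf≤maxOrder (∤⇒0<% p∤c) (m%n<n c p))
    where
    p∤c : ¬ p ∣ c
    p∤c = hasOrder⇒∤ 0<k o
    o′ : (c % p) HasOrder _
    o′ = hasOrder-cong (sym (%≈ c)) o
    order≡k : orderOf (c % p) ≡ _
    order≡k = hasOrder-unique (proj₂ (proj₂ (orderOf-spec (hasOrder⇒∤ 0<k o′)))) o′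

  combineOrders : ∀ {v b q j e′ m₂} → Prime q → ¬ q ∣ e′ → .{{_ : NonZero m₂}} →
    v HasOrder (m₂ * q ^ suc j) → b HasOrder (q ^ j * e′) → (v ^ m₂ * b ^ q ^ j) HasOrder (q ^ suc j * e′)
  combineOrders {q = q} {j} q-prime q∤e′ o-v o-b =
    hasOrder-* (Coprimality.sym (coprime-^ʳ (∤⇒coprime q-prime q∤e′) (suc j)))
      (hasOrder-^ _ o-v) (hasOrder-^ (q ^ j) {{m^n≢0 q j {{prime⇒nonZero q-prime}}}} o-b)

  -- If the order of v does not divide the maximal order e, some q^(j+1) divides it but
  -- not e = q^j e′, and then v^m₂ · maxOrderUnit^(q^j) has order q^(j+1) e′ > e.
  ^maxOrder≈1 : ∀ {v} → 0 < v → v < p → v ^ orderOf maxOrderUnit ≈ 1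
  ^maxOrder≈1 {v} 0<v v<p with orderOf-spec (0<v<p⇒∤ 0<v v<p) | orderOf-spec maxOrderUnit-∤
  ... | 0<m , _ , o-v | 0<e , _ , o-b with orderOf v ∣? orderOf maxOrderUnit
  ...   | yes m∣e = ∣⇒^≈1 o-v m∣e
  ...   | no  m∤e with excessPrimePower _ 0<m 0<e m∤e
  ...     | q , j , e′ , q-prime , e≡ , q∤e′ , divides m₂ m≡ =
    contradiction (hasOrder⇒≤maxOrder (<-trans 0<e e<order) combined) (<⇒≱ e<order)
    where
    rearrange : ∀ x e q → x * e * q ≡ q * x * e
    rearrange = solve-∀
    e<order : orderOf maxOrderUnit < q ^ suc j * e′
    e<order = subst₂ _<_ (sym e≡) (rearrange (q ^ j) e′ q)
      (m<m*n (q ^ j * e′) q {{>-nonZero (subst (0 <_) e≡ 0<e)}} (prime⇒1< q-prime))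
    0<m₂ : 0 < m₂
    0<m₂ = n≢0⇒n>0 λ { refl → <-irrefl (sym m≡) 0<m }
    combined : (v ^ m₂ * maxOrderUnit ^ q ^ j) HasOrder (q ^ suc j * e′)
    combined = combineOrders {v} {maxOrderUnit} {q} {j} q-prime q∤e′ {{>-nonZero 0<m₂}}
                 (subst (v HasOrder_) m≡ o-v) (subst (maxOrderUnit HasOrder_) e≡ o-b)

  primitiveRoot : ∃ λ g → g HasOrder N
  primitiveRoot =
    let 0<e , e≤N , o = orderOf-spec maxOrderUnit-∤
    in maxOrderUnit , subst (maxOrderUnit HasOrder_) (≤-antisym e≤N (RootsOfUnity.rootsOfUnity-bound p-prime 0<e ^maxOrder≈1)) o

  private
    powers-injective-≤ : ∀ {a m i j} → a HasOrder m → i ≤ j → j < m → a ^ i ≈ a ^ j → i ≡ j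
    powers-injective-≤ {a} {m} {i} {j} o i≤j j<m a^i≈a^j = ≤-antisym i≤j (m∸n≡0⇒m≤n j∸i≡0)
      where
      a^[j∸i]≈1 : a ^ (j ∸ i) ≈ 1
      a^[j∸i]≈1 = ^≈^⇒^∸≈1 (hasOrder⇒∤ (≤-<-trans z≤n j<m) o) i≤j a^i≈a^j
      j∸i≡0 : j ∸ i ≡ 0
      j∸i≡0 = ∣∧<⇒≡0 (^≈1⇒∣ o a^[j∸i]≈1) (≤-<-trans (m∸n≤m j i) j<m)

  powers-injective : ∀ {a m i j} → a HasOrder m → i < m → j < m → a ^ i ≈ a ^ j → i ≡ j
  powers-injective {i = i} {j} o i<m j<m a^i≈a^j with ≤-total i j
  ... | inj₁ i≤j = powers-injective-≤ o i≤j j<m a^i≈a^j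
  ... | inj₂ j≤i = sym (powers-injective-≤ o j≤i i<m (sym a^i≈a^j))

  module DiscreteLog {g} (g-order : g HasOrder N) where

    p∤g : ¬ p ∣ g
    p∤g = hasOrder⇒∤ 0<N g-order

    powers-surjective : ∀ {v} → 0 < v → v < p → ∃ λ k → k < N × g ^ k ≈ v
    powers-surjective {v} 0<v v<p =
      let i , hit = injective⇒surjective index-injective (unitIndex v p∤v)
      in toℕ i , toℕ<n i , unitIndex-injective (∤-^ p∤g (toℕ i)) p∤v hit
      where
      p∤v : ¬ p ∣ v
      p∤v = 0<v<p⇒∤ 0<v v<p
      index : Fin N → Fin N
      index i = unitIndex (g ^ toℕ i) (∤-^ p∤g (toℕ i))
      index-injective : ∀ {i j} → index i ≡ index j → i ≡ j
      index-injective {i} {j} same = toℕ-injective (powers-injective g-order (toℕ<n i) (toℕ<n j)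
        (unitIndex-injective (∤-^ p∤g (toℕ i)) (∤-^ p∤g (toℕ j)) same))

    private
      logSearch : ∀ v → ∃ λ k → k < N × (0 < v → v < p → g ^ k ≈ v)
      logSearch v with anyUpTo? (λ k → g ^ k % p ≟ v % p) N
      ... | yes (k , k<N , g^k≈v) = k , k<N , λ _ _ → g^k≈v
      ... | no  ∄                = 0 , 0<N , λ 0<v v<p → contradiction (powers-surjective 0<v v<p) ∄

    log : ℕ → ℕ
    log v = proj₁ (logSearch v)

    log<N : ∀ v → log v < N
    log<N v = proj₁ (proj₂ (logSearch v))

    ^log : ∀ {v} → 0 < v → v < p → g ^ log v ≈ v
    ^log {v} = proj₂ (proj₂ (logSearch v))

    prod≈^sumLog : ∀ {vs} → All (λ v → 0 < v × v < p) vs → prodL vs ≈ g ^ sumL (map log vs)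
    prod≈^sumLog []                        = refl
    prod≈^sumLog {v ∷ _} ((0<v , v<p) ∷ vs) =
      trans (*-cong (sym (^log 0<v v<p)) (prod≈^sumLog vs)) (cong (_% p) (sym (^-distribˡ-+-* g (log v) _)))

    prod≡⇔∣sumLog : ∀ {vs a} → All (λ v → 0 < v × v < p) vs → 0 < a → a < p →
                    N ∣ sumL (map log vs) + (N ∸ log a) ⇔ prodL vs % p ≡ a
    prod≡⇔∣sumLog {vs} {a} units 0<a a<p = mk⇔ ⇒prod ⇒∣
      where
      open ≡-Reasoning
      L = sumL (map log vs)
      c = N ∸ log a
      shift : g ^ (L + c) * g ^ log a ≈ g ^ L
      shift = begin
        g ^ (L + c) * g ^ log a % p ≡⟨ cong (_% p) (^-distribˡ-+-* g (L + c) (log a)) ⟨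
        g ^ (L + c + log a) % p     ≡⟨ cong (λ e → g ^ e % p) (trans (+-assoc L c (log a)) (cong (_+_ L) (m∸n+n≡m (<⇒≤ (log<N a))))) ⟩
        g ^ (L + N) % p             ≡⟨ cong (_% p) (^-distribˡ-+-* g L N) ⟩
        g ^ L * g ^ N % p           ≡⟨ *-cong {g ^ L} refl (∣⇒^≈1 g-order ∣-refl) ⟩
        g ^ L * 1 % p               ≡⟨ cong (_% p) (*-identityʳ (g ^ L)) ⟩
        g ^ L % p                   ∎
      ⇒prod : N ∣ L + c → prodL vs % p ≡ a
      ⇒prod N∣L+c = begin
        prodL vs % p                ≡⟨ prod≈^sumLog units ⟩
        g ^ L % p                   ≡⟨ shift ⟨
        g ^ (L + c) * g ^ log a % p ≡⟨ *-cong (∣⇒^≈1 g-order N∣L+c) (^log 0<a a<p) ⟩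
        1 * a % p                   ≡⟨ cong (_% p) (*-identityˡ a) ⟩
        a % p                       ≡⟨ m<n⇒m%n≡m a<p ⟩
        a                           ∎
      ⇒∣ : prodL vs % p ≡ a → N ∣ L + c
      ⇒∣ prod≡a = ^≈1⇒∣ g-order (*-cancelˡ-≈ (∤-^ p∤g (log a)) (begin
        g ^ log a * g ^ (L + c) % p ≡⟨ cong (_% p) (*-comm (g ^ log a) _) ⟩
        g ^ (L + c) * g ^ log a % p ≡⟨ shift ⟩
        g ^ L % p                   ≡⟨ prod≈^sumLog units ⟨
        prodL vs % p                ≡⟨ prod≡a ⟩
        a                           ≡⟨ m<n⇒m%n≡m a<p ⟨
        a % p                       ≡⟨ ^log 0<a a<p ⟨
        g ^ log a % p               ≡⟨ cong (_% p) (*-identityʳ (g ^ log a)) ⟨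
        g ^ log a * 1 % p           ∎))

-- Boolean gate lists

lookup-∷ʳ-inject₁ : ∀ {A : Set} {k} (v : Vec A k) a j → lookup (v ∷ʳ a) (inject₁ j) ≡ lookup v j
lookup-∷ʳ-inject₁ (_ ∷ᵛ _) a Fin.zero    = refl
lookup-∷ʳ-inject₁ (_ ∷ᵛ v) a (Fin.suc j) = lookup-∷ʳ-inject₁ v a j

lookup-∷ʳ-fromℕ : ∀ {A : Set} {k} (v : Vec A k) a → lookup (v ∷ʳ a) (fromℕ k) ≡ a
lookup-∷ʳ-fromℕ []ᵛ       a = refl
lookup-∷ʳ-fromℕ (_ ∷ᵛ v) a = lookup-∷ʳ-fromℕ v a

data Inject₁OrLast : ∀ {k} → Fin (suc k) → Set where
  inject₁⁺ : ∀ {k} (j : Fin k) → Inject₁OrLast (inject₁ j)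
  last⁺    : ∀ {k} → Inject₁OrLast (fromℕ k)

inject₁OrLast : ∀ {k} (i : Fin (suc k)) → Inject₁OrLast i
inject₁OrLast {zero}  Fin.zero    = last⁺
inject₁OrLast {suc k} Fin.zero    = inject₁⁺ Fin.zero
inject₁OrLast {suc k} (Fin.suc i) with inject₁OrLast i
... | inject₁⁺ j = inject₁⁺ (Fin.suc j)
... | last⁺      = last⁺

values-All : ∀ {G : ℕ → Set} {A : Set} (P : A → Set) (ev : ∀ {k} → G k → Vec A k → A) →
             (∀ {k} g v → P (ev {k} g v)) → ∀ {k} (gs : Gates G k) j → P (lookup (values ev gs) j)
values-All P ev P-ev (gs ▷ g) i with inject₁OrLast i
... | inject₁⁺ j rewrite lookup-∷ʳ-inject₁ (values ev gs) (ev g (values ev gs)) j = values-All P ev P-ev gs j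
... | last⁺      rewrite lookup-∷ʳ-fromℕ (values ev gs) (ev g (values ev gs)) = P-ev g (values ev gs)

2*maxList≤ : ∀ {B} (ys : List ℕ) → All (λ y → 2 * y ≤ B) ys → 2 * maxList ys ≤ B
2*maxList≤ []       []         = z≤n
2*maxList≤ (y ∷ ys) (2y≤ ∷ 2ys≤) =
  subst (_≤ _) (sym (*-distribˡ-⊔ 2 y (maxList ys))) (⊔-lub 2y≤ (2*maxList≤ ys 2ys≤))

≤maxList : (ys : List ℕ) → All (_≤ maxList ys) ys
≤maxList []       = []
≤maxList (y ∷ ys) = m≤m⊔n y _ ∷ All.map (λ y′≤ → ≤-trans y′≤ (m≤n⊔m y _)) (≤maxList ys)

countTrue-++ : ∀ xs ys → countTrue (xs ++ ys) ≡ countTrue xs + countTrue ys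
countTrue-++ xs ys = trans (cong sumL (map-++ bit xs ys)) (sum-++ (map bit xs) (map bit ys))

countTrue-replicate : ∀ k b → countTrue (replicate k b) ≡ k * bit b
countTrue-replicate zero    b = refl
countTrue-replicate (suc k) b = cong (bit b +_) (countTrue-replicate k b)

≡ᵇ-refl : ∀ v → (v ≡ᵇ v) ≡ true
≡ᵇ-refl v = dec-true (v ≟ v) refl

≢⇒≡ᵇ-false : ∀ {v b} → v ≢ b → (v ≡ᵇ b) ≡ false
≢⇒≡ᵇ-false {v} {b} v≢b = dec-false (v ≟ b) v≢b

replicateEach : ∀ {X : Set} → (ℕ → ℕ) → (ℕ → X) → ℕ → List X
replicateEach μ W zero    = []
replicateEach μ W (suc m) = replicate (μ (suc m)) (W (suc m)) ++ replicateEach μ W m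

replicateEach⁺ : ∀ {X : Set} {P : X → Set} μ (W : ℕ → X) m → (∀ {b} → 0 < b → b ≤ m → P (W b)) →
                 All P (replicateEach μ W m)
replicateEach⁺ μ W zero    _   = []
replicateEach⁺ μ W (suc m) P-W =
  ++⁺ (replicate⁺ (μ (suc m)) (P-W z<s ≤-refl)) (replicateEach⁺ μ W m λ 0<b b≤m → P-W 0<b (m≤n⇒m≤1+n b≤m))

weightedCount : (ℕ → ℕ) → (ℕ → Bool) → ℕ → ℕ
weightedCount μ t zero    = 0
weightedCount μ t (suc m) = μ (suc m) * bit (t (suc m)) + weightedCount μ t m

countTrue-replicateEach : ∀ {X : Set} (f : X → Bool) μ W m →
                          countTrue (map f (replicateEach μ W m)) ≡ weightedCount μ (f ∘ W) m
countTrue-replicateEach f μ W zero    = refl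
countTrue-replicateEach f μ W (suc m) = begin
  countTrue (map f (replicate (μ (suc m)) (W (suc m)) ++ replicateEach μ W m))
    ≡⟨ cong countTrue (map-++ f (replicate (μ (suc m)) (W (suc m))) (replicateEach μ W m)) ⟩
  countTrue (map f (replicate (μ (suc m)) (W (suc m))) ++ map f (replicateEach μ W m))
    ≡⟨ countTrue-++ (map f (replicate (μ (suc m)) (W (suc m)))) (map f (replicateEach μ W m)) ⟩
  countTrue (map f (replicate (μ (suc m)) (W (suc m)))) + countTrue (map f (replicateEach μ W m))
    ≡⟨ cong₂ _+_ (trans (cong countTrue (map-replicate f (μ (suc m)) (W (suc m)))) (countTrue-replicate (μ (suc m)) _))
                 (countTrue-replicateEach f μ W m) ⟩
  weightedCount μ (f ∘ W) (suc m) ∎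
  where open ≡-Reasoning

weightedCount-cong : ∀ μ {t t′} m → (∀ {b} → 0 < b → b ≤ m → t b ≡ t′ b) → weightedCount μ t m ≡ weightedCount μ t′ m
weightedCount-cong μ zero    t≗t′ = refl
weightedCount-cong μ (suc m) t≗t′ =
  cong₂ (λ u r → μ (suc m) * bit u + r) (t≗t′ z<s ≤-refl) (weightedCount-cong μ m (λ 0<b b≤m → t≗t′ 0<b (m≤n⇒m≤1+n b≤m)))

weightedCount-false : ∀ μ {t} m → (∀ {b} → 0 < b → b ≤ m → t b ≡ false) → weightedCount μ t m ≡ 0
weightedCount-false μ zero    _ = refl
weightedCount-false μ (suc m) t≡false rewrite t≡false z<s ≤-refl | *-zeroʳ (μ (suc m)) =
  weightedCount-false μ m (λ 0<b b≤m → t≡false 0<b (m≤n⇒m≤1+n b≤m))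

weightedCount-≡ᵇ : ∀ μ {v} m → 0 < v → v ≤ m → weightedCount μ (v ≡ᵇ_) m ≡ μ v
weightedCount-≡ᵇ μ {suc _} zero _ ()
weightedCount-≡ᵇ μ {v} (suc m) 0<v v≤1+m with v ≟ suc m
... | yes refl rewrite ≡ᵇ-refl (suc m) | *-identityʳ (μ (suc m)) =
  trans (cong (μ (suc m) +_) (weightedCount-false μ m λ _ b≤m → ≢⇒≡ᵇ-false (λ 1+m≡b → <⇒≱ (s≤s b≤m) (≤-reflexive 1+m≡b))))
        (+-identityʳ _)
... | no  v≢1+m rewrite ≢⇒≡ᵇ-false v≢1+m | *-zeroʳ (μ (suc m)) =
  weightedCount-≡ᵇ μ m 0<v (s≤s⁻¹ (≤∧≢⇒< v≤1+m v≢1+m))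

weightedCount-0≡ᵇ : ∀ μ m → weightedCount μ (0 ≡ᵇ_) m ≡ 0
weightedCount-0≡ᵇ μ m = weightedCount-false μ m λ { {suc _} _ _ → refl }

weightedCount-id : ∀ {v} m → v ≤ m → weightedCount id (v ≡ᵇ_) m ≡ v
weightedCount-id {zero}  m _   = weightedCount-0≡ᵇ id m
weightedCount-id {suc v} m v≤m = weightedCount-≡ᵇ id m z<s v≤m

module GateListExtension (M n : ℕ) where

  renameW : ∀ {C : Set} {k k′} → (Fin k → Fin k′) → Wire C n k → Wire C n k′
  renameW ρ (var i)  = var i
  renameW ρ (cst c)  = cst c
  renameW ρ (gate j) = gate (ρ j)

  renameG : ∀ {k k′} → (Fin k → Fin k′) → BGate M n k → BGate M n k′
  renameG ρ (AND ws)     = AND (map (renameW ρ) ws)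
  renameG ρ (OR ws)      = OR (map (renameW ρ) ws)
  renameG ρ (NOT w)      = NOT (renameW ρ w)
  renameG ρ (MOD m d ws) = MOD m d (map (renameW ρ) ws)

  bInputs-renameG : ∀ {k k′} (ρ : Fin k → Fin k′) g → bInputs (renameG ρ g) ≡ map (renameW ρ) (bInputs g)
  bInputs-renameG ρ (AND _)     = refl
  bInputs-renameG ρ (OR _)      = refl
  bInputs-renameG ρ (NOT _)     = refl
  bInputs-renameG ρ (MOD _ _ _) = refl

  _Along_≗_ : ∀ {A : Set} {k k′} → Vec A k′ → (Fin k → Fin k′) → Vec A k → Set
  v′ Along ρ ≗ v = ∀ j → lookup v′ (ρ j) ≡ lookup v j

  module _ {C A : Set} {k k′} {ρ : Fin k → Fin k′} {v : Vec A k} {v′ : Vec A k′}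
           (agree : v′ Along ρ ≗ v) (x : Fin n → A) (c : C → A) where

    wireVal-renameW : ∀ w → wireVal x c v′ (renameW ρ w) ≡ wireVal x c v w
    wireVal-renameW (var i)  = refl
    wireVal-renameW (cst a)  = refl
    wireVal-renameW (gate j) = agree j

    wireVals-renameW : ∀ ws → map (wireVal x c v′) (map (renameW ρ) ws) ≡ map (wireVal x c v) ws
    wireVals-renameW []       = refl
    wireVals-renameW (w ∷ ws) = cong₂ _∷_ (wireVal-renameW w) (wireVals-renameW ws)

  Evaluator : Set → Set
  Evaluator A = ∀ {k} → BGate M n k → Vec A k → A

  Natural : ∀ {A : Set} → Evaluator A → Set
  Natural ev = ∀ {k k′} (ρ : Fin k → Fin k′) {v v′} → v′ Along ρ ≗ v → ∀ g → ev (renameG ρ g) v′ ≡ ev g v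

  depthOf : Evaluator ℕ
  depthOf g d = suc (maxList (map (wireVal (λ _ → 0) (λ _ → 0) d) (bInputs g)))

  depthOf-natural : Natural depthOf
  depthOf-natural ρ {v′ = v′} agree g = cong (suc ∘ maxList)
    (trans (cong (map (wireVal (λ _ → 0) (λ _ → 0) v′)) (bInputs-renameG ρ g))
           (wireVals-renameW agree (λ _ → 0) (λ _ → 0) (bInputs g)))

  bGateVal-natural : ∀ x → Natural (bGateVal {M} {n} x)
  bGateVal-natural x ρ agree (AND ws)     = cong (foldr _∧_ true) (wireVals-renameW agree x id ws)
  bGateVal-natural x ρ agree (OR ws)      = cong (foldr _∨_ false) (wireVals-renameW agree x id ws)
  bGateVal-natural x ρ agree (NOT w)      = cong not (wireVal-renameW agree x id w)
  bGateVal-natural x ρ agree (MOD m _ ws) = cong (λ bs → ⌊ m ∣? countTrue bs ⌋) (wireVals-renameW agree x id ws)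

  infix 4 _≼_
  data _≼_ {k} (gs : Gates (BGate M n) k) : ∀ {k′} → Gates (BGate M n) k′ → Set where
    ≼-refl : gs ≼ gs
    _▷ʳ_   : ∀ {k′} {hs : Gates (BGate M n) k′} → gs ≼ hs → (g : BGate M n k′) → gs ≼ hs ▷ g

  ≼-trans : ∀ {k₁ k₂ k₃} {gs : Gates (BGate M n) k₁} {hs : Gates (BGate M n) k₂} {is : Gates (BGate M n) k₃} →
            gs ≼ hs → hs ≼ is → gs ≼ is
  ≼-trans gs≼hs ≼-refl         = gs≼hs
  ≼-trans gs≼hs (hs≼is ▷ʳ g) = ≼-trans gs≼hs hs≼is ▷ʳ g

  embed : ∀ {k k′} {gs : Gates (BGate M n) k} {hs : Gates (BGate M n) k′} → gs ≼ hs → Fin k → Fin k′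
  embed ≼-refl       = id
  embed (gs≼hs ▷ʳ _) = inject₁ ∘ embed gs≼hs

  values-embed : ∀ {A : Set} (ev : Evaluator A) {k k′} {gs : Gates (BGate M n) k} {hs : Gates (BGate M n) k′}
                 (gs≼hs : gs ≼ hs) → values ev hs Along embed gs≼hs ≗ values ev gs
  values-embed ev ≼-refl                     j = refl
  values-embed ev (_▷ʳ_ {hs = hs} gs≼hs g) j =
    trans (lookup-∷ʳ-inject₁ (values ev hs) (ev g (values ev hs)) (embed gs≼hs j)) (values-embed ev gs≼hs j)

  weaken : ∀ {C : Set} {k k′} {gs : Gates (BGate M n) k} {hs : Gates (BGate M n) k′} → gs ≼ hs → Wire C n k → Wire C n k′
  weaken gs≼hs = renameW (embed gs≼hs)

  wireVal-weaken : ∀ {C A : Set} (ev : Evaluator A) {k k′} {gs : Gates (BGate M n) k} {hs : Gates (BGate M n) k′}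
                   (gs≼hs : gs ≼ hs) (x : Fin n → A) (c : C → A) w →
                   wireVal x c (values ev hs) (weaken gs≼hs w) ≡ wireVal x c (values ev gs) w
  wireVal-weaken ev gs≼hs x c = wireVal-renameW (values-embed ev gs≼hs) x c

  record Appended {k} (gs : Gates (BGate M n) k) (m : ℕ) (f : ℕ → BGate M n k) : Set₁ where
    field
      size     : ℕ
      gateList : Gates (BGate M n) size
      prefix   : gs ≼ gateList
      out      : ℕ → Wire Bool n size
      out-val  : ∀ {A : Set} (ev : Evaluator A) → Natural ev → (x : Fin n → A) (c : Bool → A) →
                 ∀ {b} → b < m → wireVal x c (values ev gateList) (out b) ≡ ev (f b) (values ev gs)
      size≡    : size ≡ k + m

  append : ∀ {k} (gs : Gates (BGate M n) k) m (f : ℕ → BGate M n k) → Appended gs m f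
  append {k} gs zero    f = record
    { size = k ; gateList = gs ; prefix = ≼-refl ; out = λ _ → cst false
    ; out-val = λ _ _ _ _ () ; size≡ = sym (+-identityʳ k) }
  append {k} gs (suc m) f = record
    { size = size ; gateList = gateList ; prefix = ≼-trans (≼-refl ▷ʳ f 0) prefix
    ; out = out′ ; out-val = out-val′ ; size≡ = trans size≡ (sym (+-suc k m)) }
    where
    rest : Appended (gs ▷ f 0) m (renameG inject₁ ∘ f ∘ suc)
    rest = append (gs ▷ f 0) m (renameG inject₁ ∘ f ∘ suc)
    open Appended rest
    out′ : ℕ → Wire Bool n size
    out′ zero    = weaken prefix (gate (fromℕ k))
    out′ (suc b) = out b
    out-val′ : ∀ {A : Set} (ev : Evaluator A) → Natural ev → (x : Fin n → A) (c : Bool → A) →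
               ∀ {b} → b < suc m → wireVal x c (values ev gateList) (out′ b) ≡ ev (f b) (values ev gs)
    out-val′ ev natural x c {zero}  _         =
      trans (wireVal-weaken ev prefix x c (gate (fromℕ k))) (lookup-∷ʳ-fromℕ (values ev gs) _)
    out-val′ ev natural x c {suc b} (s≤s b<m) =
      trans (out-val ev natural x c b<m) (natural inject₁ (values-embed ev (≼-refl {gs = gs} ▷ʳ f 0)) (f (suc b)))

-- Gate-by-gate simulation of alternating arithmetic circuits

module Translation {p : ℕ} .{{_ : NonZero p}} (p-prime : Prime p) (n : ℕ) (log : ℕ → ℕ)
  (prod≡⇔∣sumLog : ∀ {vs a} → All (λ v → 0 < v × v < p) vs → 0 < a → a < p →
                   p ∸ 1 ∣ sumL (map log vs) + (p ∸ 1 ∸ log a) ⇔ prodL vs % p ≡ a) where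

  open PrimeModulus p p-prime using (1<p; N; ∤-*; ∤-^; 0<v<p⇒∤; ∤⇒0<%; ∣+∸⇔%≡)

  M : ℕ
  M = p * N

  open GateListExtension M n

  aVal : (Fin n → Bool) → ∀ {k} → Gates (AGate p n) k → Wire (Fin p) n k → ℕ
  aVal x gs = wireVal (λ i → bit (x i)) toℕ (values (aGateVal p x) gs)

  aDepth : ∀ {k} → Gates (AGate p n) k → Wire (Fin p) n k → ℕ
  aDepth gs = wireVal (λ _ → 0) (λ _ → 0) (aDepths gs)

  bVal : (Fin n → Bool) → ∀ {k} → Gates (BGate M n) k → Wire Bool n k → Bool
  bVal x gs = wireVal x id (values (bGateVal x) gs)

  bDepth : ∀ {k} → Gates (BGate M n) k → Wire Bool n k → ℕ
  bDepth gs = wireVal (λ _ → 0) (λ _ → 0) (bDepths gs)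

  bit<p : ∀ b → bit b < p
  bit<p true  = 1<p
  bit<p false = <-trans z<s 1<p

  aVal<p : ∀ x {k} (gs : Gates (AGate p n) k) w → aVal x gs w < p
  aVal<p x gs (var i)  = bit<p (x i)
  aVal<p x gs (cst c)  = toℕ<n c
  aVal<p x gs (gate j) = values-All (_< p) (aGateVal p x) gate<p gs j
    where
    gate<p : ∀ {k} (g : AGate p n k) v → aGateVal p x g v < p
    gate<p (agate plus  ws) v = m%n<n _ p
    gate<p (agate times ws) v = m%n<n _ p

  appended-val : ∀ x {k} {gs : Gates (BGate M n) k} {m f} (A : Appended gs m f) → ∀ {b} → b < m →
                 bVal x (Appended.gateList A) (Appended.out A b) ≡ bGateVal x (f b) (values (bGateVal x) gs)
  appended-val x A = Appended.out-val A (bGateVal x) (bGateVal-natural x) x id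

  appended-depth : ∀ {k} {gs : Gates (BGate M n) k} {m f} (A : Appended gs m f) → ∀ {b B} → b < m →
                   All (λ w → 2 * bDepth gs w ≤ B) (bInputs (f b)) →
                   2 * bDepth (Appended.gateList A) (Appended.out A b) ≤ 2 + B
  appended-depth {gs = gs} {f = f} A {b} {B} b<m inputs≤ = begin
    2 * bDepth (Appended.gateList A) (Appended.out A b) ≡⟨ cong (2 *_) (Appended.out-val A depthOf depthOf-natural (λ _ → 0) (λ _ → 0) b<m) ⟩
    2 * suc (maxList (map (bDepth gs) (bInputs (f b))))  ≡⟨ *-suc 2 _ ⟩
    2 + 2 * maxList (map (bDepth gs) (bInputs (f b)))    ≤⟨ +-monoʳ-≤ 2 (2*maxList≤ _ (map⁺ inputs≤)) ⟩
    2 + B                                                ∎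
    where open ≤-Reasoning

  weaken-depth : ∀ {k k′} {gs : Gates (BGate M n) k} {hs : Gates (BGate M n) k′} (gs≼hs : gs ≼ hs) w →
                 bDepth hs (weaken gs≼hs w) ≡ bDepth gs w
  weaken-depth gs≼hs = wireVal-weaken depthOf gs≼hs (λ _ → 0) (λ _ → 0)

  weaken-val : ∀ x {k k′} {gs : Gates (BGate M n) k} {hs : Gates (BGate M n) k′} (gs≼hs : gs ≼ hs) w →
               bVal x hs (weaken gs≼hs w) ≡ bVal x gs w
  weaken-val x gs≼hs = wireVal-weaken (bGateVal x) gs≼hs x id

  -- The indicator wires of a gate at arithmetic depth t lie at Boolean depth at most
  -- (3t + slack)/2 and its nonzero wire one layer deeper; the bounds below are doubled to stay in ℕ.
  slack : AOp → ℕ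
  slack plus  = 0
  slack times = 1

  slack≤1 : ∀ o → slack o ≤ 1
  slack≤1 plus  = z≤n
  slack≤1 times = s≤s z≤n

  record Simulation {k} (gsA : Gates (AGate p n) k) : Set where
    field
      size          : ℕ
      gateList      : Gates (BGate M n) size
      is            : Fin k → ℕ → Wire Bool n size
      nonzero       : Fin k → Wire Bool n size
      is-val        : ∀ x j {b} → 0 < b → b < p → bVal x gateList (is j b) ≡ (aVal x gsA (gate j) ≡ᵇ b)
      nonzero-val   : ∀ x j → bVal x gateList (nonzero j) ≡ not (aVal x gsA (gate j) ≡ᵇ 0)
      is-depth      : ∀ j {b} → 0 < b → b < p →
                      2 * bDepth gateList (is j b) ≤ 3 * aDepth gsA (gate j) + slack (lookup (aOps gsA) j)
      nonzero-depth : ∀ j → 2 * bDepth gateList (nonzero j) ≤ 3 * aDepth gsA (gate j) + slack (lookup (aOps gsA) j) + 2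
      size≤         : size ≤ k * (2 * p + 1)

  newVal : (Fin n → Bool) → ∀ {k} → Gates (AGate p n) k → AGate p n k → ℕ
  newVal x gsA g = aGateVal p x g (values (aGateVal p x) gsA)

  newDepth : ∀ {k} → Gates (AGate p n) k → AGate p n k → ℕ
  newDepth gsA g = suc (maxList (map (aDepth gsA) (inputs g)))

  record GateSimulation {k} {gsA : Gates (AGate p n) k} (S : Simulation gsA) (g : AGate p n k) : Set where
    field
      size          : ℕ
      gateList      : Gates (BGate M n) size
      prefix        : Simulation.gateList S ≼ gateList
      is            : ℕ → Wire Bool n size
      nonzero       : Wire Bool n size
      is-val        : ∀ x {b} → 0 < b → b < p → bVal x gateList (is b) ≡ (newVal x gsA g ≡ᵇ b)
      nonzero-val   : ∀ x → bVal x gateList nonzero ≡ not (newVal x gsA g ≡ᵇ 0)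
      is-depth      : ∀ {b} → 0 < b → b < p → 2 * bDepth gateList (is b) ≤ 3 * newDepth gsA g + slack (op g)
      nonzero-depth : 2 * bDepth gateList nonzero ≤ 3 * newDepth gsA g + slack (op g) + 2
      size≤         : size ≤ Simulation.size S + (2 * p + 1)

  extend : ∀ {k} {gsA : Gates (AGate p n) k} {g} (S : Simulation gsA) → GateSimulation S g → Simulation (gsA ▷ g)
  extend {k} {gsA} {g} S G = record
    { size = G.size ; gateList = G.gateList
    ; is = λ i b → pick (λ j → weaken G.prefix (S.is j b)) (G.is b) (inject₁OrLast i)
    ; nonzero = λ i → pick (λ j → weaken G.prefix (S.nonzero j)) G.nonzero (inject₁OrLast i)
    ; is-val = is-val ; nonzero-val = nonzero-val ; is-depth = is-depth ; nonzero-depth = nonzero-depth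
    ; size≤ = ≤-trans G.size≤ (subst (_≤ suc k * (2 * p + 1)) (+-comm (2 * p + 1) S.size) (+-monoʳ-≤ (2 * p + 1) S.size≤))
    }
    where
    module S = Simulation S
    module G = GateSimulation G
    pick : ∀ {A : Set} → (Fin k → A) → A → ∀ {i : Fin (suc k)} → Inject₁OrLast i → A
    pick old new (inject₁⁺ j) = old j
    pick old new last⁺        = new
    vals : (Fin n → Bool) → Vec ℕ k
    vals x = values (aGateVal p x) gsA
    is-val : ∀ x i {b} → 0 < b → b < p →
             bVal x G.gateList (pick (λ j → weaken G.prefix (S.is j b)) (G.is b) (inject₁OrLast i)) ≡
             (aVal x (gsA ▷ g) (gate i) ≡ᵇ b)
    is-val x i {b} 0<b b<p with inject₁OrLast i
    ... | inject₁⁺ j rewrite lookup-∷ʳ-inject₁ (vals x) (newVal x gsA g) j =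
      trans (weaken-val x G.prefix (S.is j b)) (S.is-val x j 0<b b<p)
    ... | last⁺ rewrite lookup-∷ʳ-fromℕ (vals x) (newVal x gsA g) = G.is-val x 0<b b<p
    nonzero-val : ∀ x i → bVal x G.gateList (pick (λ j → weaken G.prefix (S.nonzero j)) G.nonzero (inject₁OrLast i)) ≡
                  not (aVal x (gsA ▷ g) (gate i) ≡ᵇ 0)
    nonzero-val x i with inject₁OrLast i
    ... | inject₁⁺ j rewrite lookup-∷ʳ-inject₁ (vals x) (newVal x gsA g) j =
      trans (weaken-val x G.prefix (S.nonzero j)) (S.nonzero-val x j)
    ... | last⁺ rewrite lookup-∷ʳ-fromℕ (vals x) (newVal x gsA g) = G.nonzero-val x
    is-depth : ∀ i {b} → 0 < b → b < p →
               2 * bDepth G.gateList (pick (λ j → weaken G.prefix (S.is j b)) (G.is b) (inject₁OrLast i)) ≤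
               3 * aDepth (gsA ▷ g) (gate i) + slack (lookup (aOps (gsA ▷ g)) i)
    is-depth i {b} 0<b b<p with inject₁OrLast i
    ... | inject₁⁺ j rewrite lookup-∷ʳ-inject₁ (aDepths gsA) (newDepth gsA g) j | lookup-∷ʳ-inject₁ (aOps gsA) (op g) j
                           | weaken-depth G.prefix (S.is j b) = S.is-depth j 0<b b<p
    ... | last⁺ rewrite lookup-∷ʳ-fromℕ (aDepths gsA) (newDepth gsA g) | lookup-∷ʳ-fromℕ (aOps gsA) (op g) =
      G.is-depth 0<b b<p
    nonzero-depth : ∀ i → 2 * bDepth G.gateList (pick (λ j → weaken G.prefix (S.nonzero j)) G.nonzero (inject₁OrLast i)) ≤
                    3 * aDepth (gsA ▷ g) (gate i) + slack (lookup (aOps (gsA ▷ g)) i) + 2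
    nonzero-depth i with inject₁OrLast i
    ... | inject₁⁺ j rewrite lookup-∷ʳ-inject₁ (aDepths gsA) (newDepth gsA g) j | lookup-∷ʳ-inject₁ (aOps gsA) (op g) j
                           | weaken-depth G.prefix (S.nonzero j) = S.nonzero-depth j
    ... | last⁺ rewrite lookup-∷ʳ-fromℕ (aDepths gsA) (newDepth gsA g) | lookup-∷ʳ-fromℕ (aOps gsA) (op g) =
      G.nonzero-depth

  flip : AOp → AOp
  flip plus  = times
  flip times = plus

  module Inputs {k} {gsA : Gates (AGate p n) k} (S : Simulation gsA) where

    open Simulation S

    isW : Wire (Fin p) n k → ℕ → Wire Bool n size
    isW (var i)  b = if b ≡ᵇ 1 then var i else cst false
    isW (cst c)  b = cst (toℕ c ≡ᵇ b)
    isW (gate j) b = is j b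

    nonzeroW : Wire (Fin p) n k → Wire Bool n size
    nonzeroW (var i)  = var i
    nonzeroW (cst c)  = cst (not (toℕ c ≡ᵇ 0))
    nonzeroW (gate j) = nonzero j

    isW-val : ∀ x w {b} → 0 < b → b < p → bVal x gateList (isW w b) ≡ (aVal x gsA w ≡ᵇ b)
    isW-val x (var i)  {suc zero}    _ _ with x i
    ... | true  = refl
    ... | false = refl
    isW-val x (var i)  {suc (suc _)} _ _ with x i
    ... | true  = refl
    ... | false = refl
    isW-val x (cst c)  _   _   = refl
    isW-val x (gate j) 0<b b<p = is-val x j 0<b b<p

    nonzeroW-val : ∀ x w → bVal x gateList (nonzeroW w) ≡ not (aVal x gsA w ≡ᵇ 0)
    nonzeroW-val x (var i) with x i
    ... | true  = refl
    ... | false = refl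
    nonzeroW-val x (cst c)  = refl
    nonzeroW-val x (gate j) = nonzero-val x j

    isW-depth : ∀ {o} w → childOK (aOps gsA) o w → ∀ {b} → 0 < b → b < p →
                2 * bDepth gateList (isW w b) ≤ 3 * aDepth gsA w + slack (flip o)
    isW-depth (var i) _ {b} _ _ with b ≡ᵇ 1
    ... | true  = z≤n
    ... | false = z≤n
    isW-depth (cst c) _ _ _ = z≤n
    isW-depth (gate j) child 0<b b<p with lookup (aOps gsA) j | is-depth j 0<b b<p
    isW-depth (gate j) tp    0<b b<p | .times | depth = depth
    isW-depth (gate j) pt    0<b b<p | .plus  | depth = depth

    nonzeroW-depth : ∀ w → childOK (aOps gsA) times w →
                     2 * bDepth gateList (nonzeroW w) ≤ 3 * aDepth gsA w + slack plus + 2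
    nonzeroW-depth (var i)  _ = z≤n
    nonzeroW-depth (cst c)  _ = z≤n
    nonzeroW-depth (gate j) child with lookup (aOps gsA) j | nonzero-depth j
    nonzeroW-depth (gate j) pt | .plus | depth = depth

    -- An input of value v ≠ 0 contributes exactly μ v true wires, and one of value 0 none.
    indicators : (ℕ → ℕ) → List (Wire (Fin p) n k) → List (Wire Bool n size)
    indicators μ = concatMap (λ w → replicateEach μ (isW w) N)

    countTrue-indicators : ∀ x μ ws → countTrue (map (bVal x gateList) (indicators μ ws)) ≡
                           sumL (map (λ w → weightedCount μ (aVal x gsA w ≡ᵇ_) N) ws)
    countTrue-indicators x μ []       = refl
    countTrue-indicators x μ (w ∷ ws) = begin
      countTrue (map (bVal x gateList) (replicateEach μ (isW w) N ++ indicators μ ws))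
        ≡⟨ cong countTrue (map-++ (bVal x gateList) (replicateEach μ (isW w) N) (indicators μ ws)) ⟩
      countTrue (map (bVal x gateList) (replicateEach μ (isW w) N) ++ map (bVal x gateList) (indicators μ ws))
        ≡⟨ countTrue-++ (map (bVal x gateList) (replicateEach μ (isW w) N)) _ ⟩
      countTrue (map (bVal x gateList) (replicateEach μ (isW w) N)) + countTrue (map (bVal x gateList) (indicators μ ws))
        ≡⟨ cong₂ _+_ (trans (countTrue-replicateEach (bVal x gateList) μ (isW w) N)
                            (weightedCount-cong μ N λ 0<b b≤N → isW-val x w 0<b (m≤pred[n]⇒suc[m]≤n b≤N)))
                     (countTrue-indicators x μ ws) ⟩
      sumL (map (λ w → weightedCount μ (aVal x gsA w ≡ᵇ_) N) (w ∷ ws)) ∎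
      where open ≡-Reasoning

    indicators-depth : ∀ {o} μ {T} ws → AllL (childOK (aOps gsA) o) ws → All (λ w → aDepth gsA w ≤ T) ws →
                       All (λ y → 2 * bDepth gateList y ≤ 3 * T + slack (flip o)) (indicators μ ws)
    indicators-depth μ []       []           []           = []
    indicators-depth μ (w ∷ ws) (child ∷ cs) (w≤T ∷ ws≤T) =
      ++⁺ (replicateEach⁺ μ (isW w) N λ 0<b b≤N →
             ≤-trans (isW-depth w child 0<b (m≤pred[n]⇒suc[m]≤n b≤N)) (+-monoˡ-≤ _ (*-monoʳ-≤ 3 w≤T)))
          (indicators-depth μ ws cs ws≤T)

  countTrue-padded : ∀ x {k} (gs : Gates (BGate M n) k) ys c →
                     countTrue (map (bVal x gs) (ys ++ replicate c (cst true))) ≡ countTrue (map (bVal x gs) ys) + c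
  countTrue-padded x gs ys c = begin
    countTrue (map (bVal x gs) (ys ++ replicate c (cst true)))
      ≡⟨ cong countTrue (map-++ (bVal x gs) ys (replicate c (cst true))) ⟩
    countTrue (map (bVal x gs) ys ++ map (bVal x gs) (replicate c (cst true)))
      ≡⟨ countTrue-++ (map (bVal x gs) ys) _ ⟩
    countTrue (map (bVal x gs) ys) + countTrue (map (bVal x gs) (replicate c (cst true)))
      ≡⟨ cong (countTrue (map (bVal x gs) ys) +_)
              (trans (cong countTrue (map-replicate (bVal x gs) c (cst true)))
                     (trans (countTrue-replicate c true) (*-identityʳ c))) ⟩
    countTrue (map (bVal x gs) ys) + c ∎
    where open ≡-Reasoning

  module PlusGate {k} {gsA : Gates (AGate p n) k} (S : Simulation gsA)
                  (ws : List (Wire (Fin p) n k)) (children : AllL (childOK (aOps gsA) plus) ws) where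

    open Simulation S using (size; gateList)
    open Inputs S

    modInputs : ℕ → List (Wire Bool n size)
    modInputs a = indicators id ws ++ replicate (p ∸ a) (cst true)

    residueTests : Appended gateList p (λ a → MOD p (m∣m*n N) (modInputs a))
    residueTests = append gateList p _

    open Appended residueTests using () renaming (gateList to gateList₁; prefix to prefix₁; out to residueTest)

    zeroTest : Appended gateList₁ 1 (λ _ → NOT (residueTest 0))
    zeroTest = append gateList₁ 1 _

    open Appended zeroTest using () renaming (gateList to gateList₂; prefix to prefix₂; out to zeroTestOut)

    sum : (Fin n → Bool) → ℕ
    sum x = sumL (map (aVal x gsA) ws)

    residueTest-val : ∀ x {a} → a < p → bVal x gateList₁ (residueTest a) ≡ (sum x % p ≡ᵇ a)
    residueTest-val x {a} a<p = begin
      bVal x gateList₁ (residueTest a)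
        ≡⟨ appended-val x residueTests a<p ⟩
      ⌊ p ∣? countTrue (map (bVal x gateList) (modInputs a)) ⌋
        ≡⟨ cong (λ c → ⌊ p ∣? c ⌋) (countTrue-padded x gateList (indicators id ws) (p ∸ a)) ⟩
      ⌊ p ∣? countTrue (map (bVal x gateList) (indicators id ws)) + (p ∸ a) ⌋
        ≡⟨ cong (λ c → ⌊ p ∣? c + (p ∸ a) ⌋) (trans (countTrue-indicators x id ws)
             (cong sumL (map-cong (λ w → weightedCount-id N (<⇒≤pred (aVal<p x gsA w))) ws))) ⟩
      ⌊ p ∣? sum x + (p ∸ a) ⌋
        ≡⟨ trans (isYes≗does (p ∣? _)) (does-⇔ (∣+∸⇔%≡ (sum x) a<p) (p ∣? _) (sum x % p ≟ a)) ⟩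
      (sum x % p ≡ᵇ a) ∎
      where open ≡-Reasoning

    T : ℕ
    T = maxList (map (aDepth gsA) ws)

    residueTest-depth : ∀ {a} → a < p → 2 * bDepth gateList₁ (residueTest a) ≤ 2 + (3 * T + 1)
    residueTest-depth {a} a<p = appended-depth residueTests a<p
      (++⁺ (indicators-depth id ws children (map⁻ (≤maxList (map (aDepth gsA) ws)))) (replicate⁺ (p ∸ a) z≤n))

    simulation : GateSimulation S (agate plus ws)
    simulation = record
      { size = _ ; gateList = gateList₂ ; prefix = ≼-trans prefix₁ prefix₂
      ; is = λ b → weaken prefix₂ (residueTest b) ; nonzero = zeroTestOut 0
      ; is-val = λ x {b} _ b<p → trans (weaken-val x prefix₂ (residueTest b)) (residueTest-val x b<p)
      ; nonzero-val = λ x → trans (appended-val x zeroTest z<s) (cong not (residueTest-val x (<-trans z<s 1<p)))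
      ; is-depth = λ {b} _ b<p → subst₂ _≤_ (cong (2 *_) (sym (weaken-depth prefix₂ (residueTest b)))) (lemma₁ T)
                                   (residueTest-depth b<p)
      ; nonzero-depth = subst (2 * bDepth gateList₂ (zeroTestOut 0) ≤_) (lemma₂ T)
                          (appended-depth zeroTest z<s (residueTest-depth (<-trans z<s 1<p) ∷ []))
      ; size≤ = begin
          Appended.size zeroTest    ≡⟨ Appended.size≡ zeroTest ⟩
          Appended.size residueTests + 1 ≡⟨ cong (_+ 1) (Appended.size≡ residueTests) ⟩
          size + p + 1              ≤⟨ m≤m+n (size + p + 1) p ⟩
          size + p + 1 + p          ≡⟨ lemma₃ size p ⟩
          size + (2 * p + 1)        ∎
      }
      where
      open ≤-Reasoning
      lemma₃ : ∀ s p → s + p + 1 + p ≡ s + (2 * p + 1)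
      lemma₃ = solve-∀
      lemma₁ : ∀ t → 2 + (3 * t + 1) ≡ 3 * suc t + 0
      lemma₁ = solve-∀
      lemma₂ : ∀ t → 2 + (2 + (3 * t + 1)) ≡ 3 * suc t + 0 + 2
      lemma₂ = solve-∀

  allNonzero : List ℕ → Bool
  allNonzero vs = foldr _∧_ true (map (λ v → not (v ≡ᵇ 0)) vs)

  units⊎hasZero : ∀ vs → All (_< p) vs →
                  (All (λ v → 0 < v × v < p) vs × allNonzero vs ≡ true) ⊎ (allNonzero vs ≡ false × prodL vs ≡ 0)
  units⊎hasZero []           _            = inj₁ ([] , refl)
  units⊎hasZero (zero ∷ _)   _            = inj₂ (refl , refl)
  units⊎hasZero (suc v ∷ vs) (v<p ∷ vs<p) with units⊎hasZero vs vs<p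
  ... | inj₁ (units , allNZ) = inj₁ ((z<s , v<p) ∷ units , allNZ)
  ... | inj₂ (notAllNZ , ∏≡0) = inj₂ (notAllNZ , trans (cong (suc v *_) ∏≡0) (*-zeroʳ (suc v)))

  units⇒∤prod : ∀ {vs} → All (λ v → 0 < v × v < p) vs → ¬ p ∣ prodL vs
  units⇒∤prod []                  = ∤-^ {1} (0<v<p⇒∤ z<s 1<p) 0
  units⇒∤prod ((0<v , v<p) ∷ vs) = ∤-* (0<v<p⇒∤ 0<v v<p) (units⇒∤prod vs)

  logWeight : ℕ → ℕ
  logWeight v = weightedCount log (v ≡ᵇ_) N

  productTest-correct : ∀ vs {a} → All (_< p) vs → 0 < a → a < p →
    ⌊ N ∣? sumL (map logWeight vs) + (N ∸ log a) ⌋ ∧ allNonzero vs ≡ (prodL vs % p ≡ᵇ a)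
  productTest-correct vs {a} vs<p 0<a a<p with units⊎hasZero vs vs<p
  ... | inj₁ (units , allNZ) rewrite allNZ | ∧-identityʳ ⌊ N ∣? sumL (map logWeight vs) + (N ∸ log a) ⌋ =
    trans (cong (λ s → ⌊ N ∣? s + (N ∸ log a) ⌋) (cong sumL (map-cong-local (All.map
            (λ (0<v , v<p) → weightedCount-≡ᵇ log N 0<v (<⇒≤pred v<p)) units))))
      (trans (isYes≗does (N ∣? _)) (does-⇔ (prod≡⇔∣sumLog units 0<a a<p) (N ∣? _) (prodL vs % p ≟ a)))
  ... | inj₂ (notAllNZ , ∏≡0) rewrite notAllNZ | ∏≡0 | m<n⇒m%n≡m (<-trans z<s 1<p) =
    trans (∧-zeroʳ _) (sym (≢⇒≡ᵇ-false (<⇒≢ 0<a)))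

  nonzero-correct : ∀ vs → All (_< p) vs → allNonzero vs ≡ not (prodL vs % p ≡ᵇ 0)
  nonzero-correct vs vs<p with units⊎hasZero vs vs<p
  ... | inj₁ (units , allNZ) rewrite allNZ | ≢⇒≡ᵇ-false (≢-sym (<⇒≢ (∤⇒0<% (units⇒∤prod units)))) = refl
  ... | inj₂ (notAllNZ , ∏≡0) rewrite notAllNZ | ∏≡0 | m<n⇒m%n≡m (<-trans z<s 1<p) = refl

  module TimesGate {k} {gsA : Gates (AGate p n) k} (S : Simulation gsA)
                   (ws : List (Wire (Fin p) n k)) (children : AllL (childOK (aOps gsA) times) ws) where

    open Simulation S using (size; gateList)
    open Inputs S

    modInputs : ℕ → List (Wire Bool n size)
    modInputs a = indicators log ws ++ replicate (N ∸ log a) (cst true)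

    logTests : Appended gateList p (λ a → MOD N (n∣m*n p) (modInputs a))
    logTests = append gateList p _

    open Appended logTests using () renaming (gateList to gateList₁; prefix to prefix₁; out to logTest)

    nonzeroInputs : ∀ {k′} {hs : Gates (BGate M n) k′} → gateList ≼ hs → List (Wire Bool n k′)
    nonzeroInputs gs≼hs = map (weaken gs≼hs ∘ nonzeroW) ws

    productTests : Appended gateList₁ p (λ a → AND (logTest a ∷ nonzeroInputs prefix₁))
    productTests = append gateList₁ p _

    open Appended productTests using () renaming (gateList to gateList₂; prefix to prefix₂; out to productTest)

    nonzeroTest : Appended gateList₂ 1 (λ _ → AND (nonzeroInputs (≼-trans prefix₁ prefix₂)))
    nonzeroTest = append gateList₂ 1 _

    open Appended nonzeroTest using () renaming (gateList to gateList₃; prefix to prefix₃; out to nonzeroTestOut)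

    inputVals : (Fin n → Bool) → List ℕ
    inputVals x = map (aVal x gsA) ws

    inputVals<p : ∀ x → All (_< p) (inputVals x)
    inputVals<p x = map⁺ (All.universal (aVal<p x gsA) ws)

    nonzeroInputs-val : ∀ x {k′} {hs : Gates (BGate M n) k′} (gs≼hs : gateList ≼ hs) →
                        foldr _∧_ true (map (bVal x hs) (nonzeroInputs gs≼hs)) ≡ allNonzero (inputVals x)
    nonzeroInputs-val x {hs = hs} gs≼hs = go ws
      where
      go : ∀ ws′ → foldr _∧_ true (map (bVal x hs) (map (weaken gs≼hs ∘ nonzeroW) ws′)) ≡ allNonzero (map (aVal x gsA) ws′)
      go []        = refl
      go (w ∷ ws′) = cong₂ _∧_ (trans (weaken-val x gs≼hs (nonzeroW w)) (nonzeroW-val x w)) (go ws′)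

    logTest-val : ∀ x {a} → a < p →
                  bVal x gateList₁ (logTest a) ≡ ⌊ N ∣? sumL (map logWeight (inputVals x)) + (N ∸ log a) ⌋
    logTest-val x {a} a<p = begin
      bVal x gateList₁ (logTest a)
        ≡⟨ appended-val x logTests a<p ⟩
      ⌊ N ∣? countTrue (map (bVal x gateList) (modInputs a)) ⌋
        ≡⟨ cong (λ c → ⌊ N ∣? c ⌋) (countTrue-padded x gateList (indicators log ws) (N ∸ log a)) ⟩
      ⌊ N ∣? countTrue (map (bVal x gateList) (indicators log ws)) + (N ∸ log a) ⌋
        ≡⟨ cong (λ c → ⌊ N ∣? c + (N ∸ log a) ⌋) (trans (countTrue-indicators x log ws) (cong sumL (map-∘ ws))) ⟩
      ⌊ N ∣? sumL (map logWeight (inputVals x)) + (N ∸ log a) ⌋ ∎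
      where open ≡-Reasoning

    productTest-val : ∀ x {a} → 0 < a → a < p → bVal x gateList₂ (productTest a) ≡ (prodL (inputVals x) % p ≡ᵇ a)
    productTest-val x {a} 0<a a<p = begin
      bVal x gateList₂ (productTest a)
        ≡⟨ appended-val x productTests a<p ⟩
      bVal x gateList₁ (logTest a) ∧ foldr _∧_ true (map (bVal x gateList₁) (nonzeroInputs prefix₁))
        ≡⟨ cong₂ _∧_ (logTest-val x a<p) (nonzeroInputs-val x prefix₁) ⟩
      ⌊ N ∣? sumL (map logWeight (inputVals x)) + (N ∸ log a) ⌋ ∧ allNonzero (inputVals x)
        ≡⟨ productTest-correct (inputVals x) (inputVals<p x) 0<a a<p ⟩
      (prodL (inputVals x) % p ≡ᵇ a) ∎
      where open ≡-Reasoning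

    T : ℕ
    T = maxList (map (aDepth gsA) ws)

    inputDepths≤T : All (λ w → aDepth gsA w ≤ T) ws
    inputDepths≤T = map⁻ (≤maxList (map (aDepth gsA) ws))

    nonzeroInputs-depth : ∀ {k′} {hs : Gates (BGate M n) k′} (gs≼hs : gateList ≼ hs) →
                          All (λ y → 2 * bDepth hs y ≤ 2 + (3 * T + 0)) (nonzeroInputs gs≼hs)
    nonzeroInputs-depth {hs = hs} gs≼hs = map⁺ (go ws children inputDepths≤T)
      where
      go : ∀ ws′ → AllL (childOK (aOps gsA) times) ws′ → All (λ w → aDepth gsA w ≤ T) ws′ →
           All (λ w → 2 * bDepth hs (weaken gs≼hs (nonzeroW w)) ≤ 2 + (3 * T + 0)) ws′
      go []        []           []           = []
      go (w ∷ ws′) (child ∷ cs) (w≤T ∷ ws≤T) =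
        subst (_≤ 2 + (3 * T + 0)) (cong (2 *_) (sym (weaken-depth gs≼hs (nonzeroW w))))
          (≤-trans (nonzeroW-depth w child) (subst (3 * aDepth gsA w + 0 + 2 ≤_) (+-comm (3 * T + 0) 2)
            (+-monoˡ-≤ 2 (+-monoˡ-≤ 0 (*-monoʳ-≤ 3 w≤T)))))
        ∷ go ws′ cs ws≤T

    logTest-depth : ∀ {a} → a < p → 2 * bDepth gateList₁ (logTest a) ≤ 2 + (3 * T + 0)
    logTest-depth {a} a<p = appended-depth logTests a<p
      (++⁺ (indicators-depth log ws children inputDepths≤T) (replicate⁺ (N ∸ log a) z≤n))

    productTest-depth : ∀ {a} → a < p → 2 * bDepth gateList₂ (productTest a) ≤ 2 + (2 + (3 * T + 0))
    productTest-depth a<p = appended-depth productTests a<p (logTest-depth a<p ∷ nonzeroInputs-depth prefix₁)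

    simulation : GateSimulation S (agate times ws)
    simulation = record
      { size = _ ; gateList = gateList₃ ; prefix = ≼-trans (≼-trans prefix₁ prefix₂) prefix₃
      ; is = λ b → weaken prefix₃ (productTest b) ; nonzero = nonzeroTestOut 0
      ; is-val = λ x {b} 0<b b<p → trans (weaken-val x prefix₃ (productTest b)) (productTest-val x 0<b b<p)
      ; nonzero-val = λ x → trans (appended-val x nonzeroTest z<s)
                              (trans (nonzeroInputs-val x (≼-trans prefix₁ prefix₂)) (nonzero-correct (inputVals x) (inputVals<p x)))
      ; is-depth = λ {b} _ b<p → subst₂ _≤_ (cong (2 *_) (sym (weaken-depth prefix₃ (productTest b)))) (lemma₁ T)
                                   (productTest-depth b<p)
      ; nonzero-depth = ≤-trans (appended-depth nonzeroTest z<s (nonzeroInputs-depth (≼-trans prefix₁ prefix₂)))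
                                (≤-reflexive-+ T)
      ; size≤ = ≤-reflexive (begin
          Appended.size nonzeroTest                  ≡⟨ Appended.size≡ nonzeroTest ⟩
          Appended.size productTests + 1             ≡⟨ cong (_+ 1) (Appended.size≡ productTests) ⟩
          Appended.size logTests + p + 1             ≡⟨ cong (λ s → s + p + 1) (Appended.size≡ logTests) ⟩
          size + p + p + 1                           ≡⟨ lemma₃ size p ⟩
          size + (2 * p + 1)                         ∎)
      }
      where
      open ≡-Reasoning
      lemma₁ : ∀ t → 2 + (2 + (3 * t + 0)) ≡ 3 * suc t + 1
      lemma₁ = solve-∀
      ≤-reflexive-+ : ∀ t → 2 + (2 + (3 * t + 0)) ≤ 3 * suc t + 1 + 2
      ≤-reflexive-+ t = subst (_≤ 3 * suc t + 1 + 2) (sym (lemma₁ t)) (m≤m+n (3 * suc t + 1) 2)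
      lemma₃ : ∀ s p → s + p + p + 1 ≡ s + (2 * p + 1)
      lemma₃ = solve-∀

  simulate : ∀ {k} (gsA : Gates (AGate p n) k) → AlternatingGates gsA → Simulation gsA
  simulate []                    _                 = record
    { size = 0 ; gateList = [] ; is = λ () ; nonzero = λ ()
    ; is-val = λ _ () ; nonzero-val = λ _ () ; is-depth = λ () ; nonzero-depth = λ () ; size≤ = z≤n }
  simulate (gsA ▷ agate plus ws)  (alt , children) =
    extend (simulate gsA alt) (PlusGate.simulation (simulate gsA alt) ws children)
  simulate (gsA ▷ agate times ws) (alt , children) =
    extend (simulate gsA alt) (TimesGate.simulation (simulate gsA alt) ws children)

  bit-≡ᵇ1 : ∀ {v} → v < p → v % p ≡ 0 ⊎ v % p ≡ 1 → bit (v ≡ᵇ 1) ≡ v % p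
  bit-≡ᵇ1 v<p v%p∈01 rewrite m<n⇒m%n≡m v<p with v%p∈01
  ... | inj₁ refl = refl
  ... | inj₂ refl = refl

  compile : ∀ {s d} (C : ArithCircuit p n s) → Alternating C → depthA C ≤ 2 * d →
            ((x : Fin n → Bool) → evalA p C x ≡ 0 ⊎ evalA p C x ≡ 1) →
            Σ ℕ λ s′ → Σ (BoolCircuit M n s′) λ C′ →
              (s′ ≤ 3 * (s * p)) × (depthB C′ ≤ 3 * d) × ((x : Fin n → Bool) → bit (evalB C′ x) ≡ evalA p C x)
  compile {s} {d} (circuit gsA w) alt depth≤ boolean =
    size , circuit gateList (outWire w) , size-bound , depth-bound w depth≤ , correct w boolean
    where
    open Simulation (simulate gsA alt)
    outWire : Wire (Fin p) n s → Wire Bool n size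
    outWire (var i)  = var i
    outWire (cst c)  = cst (toℕ c ≡ᵇ 1)
    outWire (gate j) = is j 1
    size-bound : size ≤ 3 * (s * p)
    size-bound = ≤-trans size≤ (*[2p+1]≤3*[*p] s (<-trans z<s 1<p))
    depth-bound : ∀ w → aDepth gsA w ≤ 2 * d → bDepth gateList (outWire w) ≤ 3 * d
    depth-bound (var i)  _ = z≤n
    depth-bound (cst c)  _ = z≤n
    depth-bound (gate j) t≤2d = halve (begin
      2 * bDepth gateList (is j 1)                              ≤⟨ is-depth j z<s 1<p ⟩
      3 * aDepth gsA (gate j) + slack (lookup (aOps gsA) j)     ≤⟨ +-mono-≤ (*-monoʳ-≤ 3 t≤2d) (slack≤1 (lookup (aOps gsA) j)) ⟩
      3 * (2 * d) + 1                                           ≡⟨ cong (_+ 1) (lemma d) ⟩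
      2 * (3 * d) + 1                                           ∎)
      where
      open ≤-Reasoning
      lemma : ∀ d → 3 * (2 * d) ≡ 2 * (3 * d)
      lemma = solve-∀
    correct : ∀ w → ((x : Fin n → Bool) → aVal x gsA w % p ≡ 0 ⊎ aVal x gsA w % p ≡ 1) →
              ∀ x → bit (bVal x gateList (outWire w)) ≡ aVal x gsA w % p
    correct (var i)  _       x = sym (m<n⇒m%n≡m (bit<p (x i)))
    correct (cst c)  boolean x = bit-≡ᵇ1 (toℕ<n c) (boolean x)
    correct (gate j) boolean x rewrite is-val x j z<s 1<p = bit-≡ᵇ1 (aVal<p x gsA (gate j)) (boolean x)

lemma4p2 : Σ ℕ λ K →
    (p : ℕ) .{{_ : NonZero p}} → Prime p →
    (n s d : ℕ) (C : ArithCircuit p n s) →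
    Alternating C → depthA C ≤ 2 * d →
    ((x : Fin n → Bool) → evalA p C x ≡ 0 ⊎ evalA p C x ≡ 1) →
    Σ ℕ λ s′ → Σ (BoolCircuit (p * (p ∸ 1)) n s′) λ C′ →
      (s′ ≤ K * (s * p)) × (depthB C′ ≤ 3 * d) ×
      ((x : Fin n → Bool) → bit (evalB C′ x) ≡ evalA p C x)
lemma4p2 = 3 , λ p {{p≢0}} p-prime n s d →
  let open PrimeModulus.DiscreteLog p p-prime (proj₂ (PrimeModulus.primitiveRoot p p-prime))
  in Translation.compile {{p≢0}} p-prime n log prod≡⇔∣sumLog {s} {d}
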